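{- Let $D=(d_1,d_2,\ldots,d_n)$ be a non-negative and non-increasing integer sequence. Then $D$ is a forcibly unicyclic graphic sequence if and only if one of the following holds: (1) $D=(2^5)$ or $D=(3,2^4,1)$; (2) $D=(n-2,2^3,1^{n-4})$, where $n\ge 4$; (3) $D=(r,s,t,1^{n-3})$, where $n\ge 3$, $r\ge s\ge t\ge 2$ and $r+s+t=n+3$.
   Context: All graphs are finite and simple. A sequence $D=(d_1,\ldots,d_n)$ of non-negative integers is graphic if there is a simple graph with vertices $v_1,\ldots,v_n$ with $\deg(v_i)=d_i$ for all $i$; such a graph is a realization of $D$. A graphic sequence $D$ is forcibly $\mathcal{P}$ graphic if every realization of $D$ has property $\mathcal{P}$. A graph of order $n$ is unicyclic if it is connected and has exactly $n$ edges. The notation $(a_1^{c_1},\ldots,a_k^{c_k})$ means the sequence in which $a_i$ appears $c_i$ times (exponent $0$ means the term is absent). -}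

module Defs where

open import Data.Nat using (ℕ; zero; suc; _+_; _∸_; _≤_; _<ᵇ_)
open import Data.Bool using (Bool; true; false; if_then_else_; _∧_)
open import Data.Fin using (Fin; toℕ)
open import Data.List using (List; _∷_; []; length; lookup; map; allFin; replicate; _++_)
open import Data.Nat.ListAction using (sum)
open import Data.Product using (Σ; ∃; ∃-syntax; _×_; _,_)
open import Data.Sum using (_⊎_)
open import Relation.Binary.PropositionalEquality using (_≡_)

record Graph (n : ℕ) : Set where
  field
    adj    : Fin n → Fin n → Bool
    sym    : ∀ i j → adj i j ≡ adj j i
    irrefl : ∀ i → adj i i ≡ false
open Graph public

indicator : Bool → ℕ
indicator true  = 1
indicator false = 0

degree : ∀ {n} → Graph n → Fin n → ℕ
degree {n} G i = sum (map (λ j → indicator (adj G i j)) (allFin n))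

edgeCount : ∀ {n} → Graph n → ℕ
edgeCount {n} G =
  sum (map (λ i → sum (map (λ j → indicator (adj G i j ∧ (toℕ i <ᵇ toℕ j))) (allFin n))) (allFin n))

data Reach {n : ℕ} (G : Graph n) : Fin n → Fin n → Set where
  here : ∀ {i} → Reach G i i
  step : ∀ {i j k} → adj G i j ≡ true → Reach G j k → Reach G i k

Connected : ∀ {n} → Graph n → Set
Connected {n} G = (1 ≤ n) × (∀ i j → Reach G i j)

Unicyclic : ∀ {n} → Graph n → Set
Unicyclic {n} G = Connected G × (edgeCount G ≡ n)

Realizes : (D : List ℕ) → Graph (length D) → Set
Realizes D G = ∀ i → degree G i ≡ lookup D i

Graphic : List ℕ → Set
Graphic D = Σ (Graph (length D)) (Realizes D)

ForciblyUnicyclicGraphic : List ℕ → Set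
ForciblyUnicyclicGraphic D =
  Graphic D × (∀ (G : Graph (length D)) → Realizes D G → Unicyclic G)

NonIncreasing : List ℕ → Set
NonIncreasing D = ∀ (i j : Fin (length D)) → toℕ i ≤ toℕ j → lookup D j ≤ lookup D i

Case1 : List ℕ → Set
Case1 D = (D ≡ replicate 5 2) ⊎ (D ≡ 3 ∷ replicate 4 2 ++ 1 ∷ [])

Case2 : List ℕ → Set
Case2 D = let n = length D in
  (4 ≤ n) × (D ≡ (n ∸ 2) ∷ replicate 3 2 ++ replicate (n ∸ 4) 1)

Case3 : List ℕ → Set
Case3 D = let n = length D in
  (3 ≤ n) × ∃[ r ] ∃[ s ] ∃[ t ]
    ((s ≤ r) × (t ≤ s) × (2 ≤ t) × (r + s + t ≡ n + 3) ×
     (D ≡ r ∷ s ∷ t ∷ replicate (n ∸ 3) 1))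

-- A realization of a sequence in case (1)-(3) has degree sum 2n, hence n edges, and it is connected.
-- In case (3) the leaves absorb at most n - 3 of the degree sum n + 3 of the three large vertices, so
-- these form a triangle and every leaf is attached to it.  In case (2) vertex 0 has degree n - 2, so
-- every vertex lies within distance two of it; in case (1) any two non-adjacent vertices of degree at
-- least 2 have a common neighbour.  Cycles with pendant vertices show that these sequences are graphic.
--
-- Conversely, a unicyclic graph has no isolated vertex, so if D is forcibly unicyclic with k terms at
-- least 2, all other terms are 1 and the large terms sum to n + k.  Then k <= 2 is impossible and k = 3
-- is case (3).  For k >= 4, D has a disconnected realization unless it is in case (1) or (2): if
-- d 1 >= 3, a cycle through the large vertices with a chord plus an edge joining two leaves; if
-- d 1 = 2, two disjoint cycles, or two triangles sharing a vertex plus an edge, with the remaining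
-- leaves hung on vertex 0.
module Submission where

open import Defs hiding (sym)
open import Data.Nat
  using (ℕ; zero; suc; _+_; _*_; _∸_; _≤_; _<_; z≤n; s≤s; _<ᵇ_; _≡ᵇ_; pred; _≤?_; _<?_)
open import Data.Nat.Properties
open import Data.Nat.Tactic.RingSolver using (solve-∀)
open import Data.Bool using (Bool; true; false; _∧_; _∨_; not; if_then_else_)
open import Data.Bool.Properties
  using (∨-comm; ∧-comm; ∨-zeroʳ; ∨-identityʳ; ∧-conicalˡ; ∧-conicalʳ; ¬-not; not-injective; T-≡)
  renaming (_≟_ to _≟𝔹_)
open import Data.Fin using (Fin; toℕ; fromℕ<) renaming (zero to fz; suc to fs)
open import Data.Fin.Properties using (toℕ-fromℕ<; toℕ-injective; toℕ<n; any?)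
  renaming (_≟_ to _≟F_; suc-injective to fs-injective)
open import Data.List using (List; _∷_; []; length; lookup; map; allFin; replicate; _++_; tabulate)
open import Data.List.Properties using (map-tabulate; length-replicate; length-++)
open import Data.Nat.ListAction using (sum)
open import Algebra.Properties.CommutativeMonoid.Sum +-0-commutativeMonoid
  using (sum-syntax; ∑-distrib-+; ∑-comm; sum-cong-≗; sum-replicate-zero) renaming (sum to ∑)
open import Data.Product using (Σ; ∃-syntax; _×_; _,_; proj₁; proj₂)
open import Data.Sum using (_⊎_; inj₁; inj₂; [_,_]′)
open import Data.Empty using (⊥; ⊥-elim)
open import Relation.Nullary using (¬_; Dec; yes; no)
open import Relation.Binary using (tri<; tri≈; tri>)
open import Relation.Binary.PropositionalEquality
  using (_≡_; _≢_; refl; sym; trans; cong; cong₂; subst; subst₂; module ≡-Reasoning)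
open import Function using (id)
open import Function.Bundles using (_⇔_; mk⇔; Equivalence)

false≢true : false ≢ true
false≢true ()

indicator≤1 : ∀ b → indicator b ≤ 1
indicator≤1 true  = s≤s z≤n
indicator≤1 false = z≤n

∨-true⇒⊎ : ∀ a b → (a ∨ b) ≡ true → (a ≡ true) ⊎ (b ≡ true)
∨-true⇒⊎ true  b e = inj₁ refl
∨-true⇒⊎ false b e = inj₂ e

≡true⇔≡true⇒≡ : ∀ (a b : Bool) → (a ≡ true → b ≡ true) → (b ≡ true → a ≡ true) → a ≡ b
≡true⇔≡true⇒≡ true  true  f g = refl
≡true⇔≡true⇒≡ true  false f g = sym (f refl)
≡true⇔≡true⇒≡ false true  f g = g refl
≡true⇔≡true⇒≡ false false f g = refl

≡ᵇ-refl : ∀ n → (n ≡ᵇ n) ≡ true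
≡ᵇ-refl n = Equivalence.to T-≡ (≡⇒≡ᵇ n n refl)

≡ᵇ-true⇒≡ : ∀ m n → (m ≡ᵇ n) ≡ true → m ≡ n
≡ᵇ-true⇒≡ m n e = ≡ᵇ⇒≡ m n (Equivalence.from T-≡ e)

≢⇒≡ᵇ-false : ∀ {m n} → m ≢ n → (m ≡ᵇ n) ≡ false
≢⇒≡ᵇ-false {m} {n} m≢n = ¬-not (λ e → m≢n (≡ᵇ-true⇒≡ m n e))

<ᵇ-true⇒< : ∀ m n → (m <ᵇ n) ≡ true → m < n
<ᵇ-true⇒< m n e = <ᵇ⇒< m n (Equivalence.from T-≡ e)

<⇒<ᵇ-true : ∀ {m n} → m < n → (m <ᵇ n) ≡ true
<⇒<ᵇ-true m<n = Equivalence.to T-≡ (<⇒<ᵇ m<n)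

<ᵇ-false⇒≥ : ∀ {m n} → (m <ᵇ n) ≡ false → n ≤ m
<ᵇ-false⇒≥ e = ≮⇒≥ (λ m<n → false≢true (trans (sym e) (<⇒<ᵇ-true m<n)))

≥⇒<ᵇ-false : ∀ {m n} → n ≤ m → (m <ᵇ n) ≡ false
≥⇒<ᵇ-false {m} {n} n≤m = ¬-not (λ e → <⇒≱ (<ᵇ-true⇒< m n e) n≤m)

≡ᵇ-true⊎⇒≡⊎ : ∀ j p q → ((j ≡ᵇ p) ∨ (j ≡ᵇ q)) ≡ true → (j ≡ p) ⊎ (j ≡ q)
≡ᵇ-true⊎⇒≡⊎ j p q e with ∨-true⇒⊎ _ _ e
... | inj₁ e₁ = inj₁ (≡ᵇ-true⇒≡ j p e₁)
... | inj₂ e₂ = inj₂ (≡ᵇ-true⇒≡ j q e₂)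

≡⊎⇒≡ᵇ-true⊎ : ∀ j p q → (j ≡ p) ⊎ (j ≡ q) → ((j ≡ᵇ p) ∨ (j ≡ᵇ q)) ≡ true
≡⊎⇒≡ᵇ-true⊎ j p q (inj₁ refl) rewrite ≡ᵇ-refl j = refl
≡⊎⇒≡ᵇ-true⊎ j p q (inj₂ refl) rewrite ≡ᵇ-refl j = ∨-zeroʳ (j ≡ᵇ p)

sumᶠ-≤ : ∀ n {f g : Fin n → ℕ} → (∀ i → f i ≤ g i) → ∑[ i < n ] f i ≤ ∑[ i < n ] g i
sumᶠ-≤ zero    f≤g = z≤n
sumᶠ-≤ (suc n) f≤g = +-mono-≤ (f≤g fz) (sumᶠ-≤ n (λ j → f≤g (fs j)))

sumᶠ-const1 : ∀ n → ∑[ i < n ] 1 ≡ n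
sumᶠ-const1 zero    = refl
sumᶠ-const1 (suc n) = cong suc (sumᶠ-const1 n)

sumᶠ-≤1⇒≤n : ∀ n (f : Fin n → ℕ) → (∀ i → f i ≤ 1) → ∑[ i < n ] f i ≤ n
sumᶠ-≤1⇒≤n n f f≤1 = subst (∑[ i < n ] f i ≤_) (sumᶠ-const1 n) (sumᶠ-≤ n f≤1)

term≤sumᶠ : ∀ n (f : Fin n → ℕ) (i : Fin n) → f i ≤ ∑[ j < n ] f j
term≤sumᶠ (suc n) f fz     = m≤m+n _ _
term≤sumᶠ (suc n) f (fs i) = ≤-trans (term≤sumᶠ n (λ j → f (fs j)) i) (m≤n+m _ _)

sumᶠ≡n⇒all≡1 : ∀ n (f : Fin n → ℕ) → (∀ i → f i ≤ 1) → ∑[ i < n ] f i ≡ n → ∀ i → f i ≡ 1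
sumᶠ≡n⇒all≡1 (suc n) f f≤1 sum≡ i with f fz in f0≡ | f≤1 fz
... | 0 | _ = ⊥-elim (1+n≰n (≤-trans (≤-reflexive (sym sum≡))
                    (sumᶠ-≤1⇒≤n n (λ j → f (fs j)) (λ j → f≤1 (fs j)))))
... | suc (suc _) | s≤s ()
... | 1 | _ with i
...   | fz   = f0≡
...   | fs i = sumᶠ≡n⇒all≡1 n (λ j → f (fs j)) (λ j → f≤1 (fs j)) (suc-injective sum≡) i

δ : ∀ {n} → Fin n → Fin n → ℕ
δ a j with j ≟F a
... | yes _ = 1
... | no _  = 0

δ-self : ∀ {n} (a : Fin n) → δ a a ≡ 1
δ-self a with a ≟F a
... | yes _  = refl
... | no a≢a = ⊥-elim (a≢a refl)

δ-other : ∀ {n} (a j : Fin n) → j ≢ a → δ a j ≡ 0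
δ-other a j j≢a with j ≟F a
... | yes j≡a = ⊥-elim (j≢a j≡a)
... | no _    = refl

sumᶠ-δ : ∀ n (a : Fin n) → ∑[ j < n ] δ a j ≡ 1
sumᶠ-δ (suc n) fz = cong₂ _+_ (δ-self {suc n} fz)
  (trans (sum-cong-≗ {n} (λ j → δ-other fz (fs j) λ ())) (sum-replicate-zero n))
sumᶠ-δ (suc n) (fs a) = cong₂ _+_ (δ-other (fs a) fz λ ())
  (trans (sum-cong-≗ {n} (λ j → δ-shift j (j ≟F a))) (sumᶠ-δ n a))
  where
  δ-shift : ∀ j → Dec (j ≡ a) → δ (fs a) (fs j) ≡ δ a j
  δ-shift j (yes refl) = trans (δ-self (fs j)) (sym (δ-self j))
  δ-shift j (no j≢a)   = trans (δ-other (fs a) (fs j) (λ e → j≢a (fs-injective e)))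
                               (sym (δ-other a j j≢a))

sum-tabulate≡sumᶠ : ∀ n (f : Fin n → ℕ) → sum (tabulate f) ≡ ∑[ i < n ] f i
sum-tabulate≡sumᶠ zero    f = refl
sum-tabulate≡sumᶠ (suc n) f = cong (f fz +_) (sum-tabulate≡sumᶠ n (λ j → f (fs j)))

sum-map-allFin : ∀ n (f : Fin n → ℕ) → sum (map f (allFin n)) ≡ ∑[ i < n ] f i
sum-map-allFin n f = trans (cong sum (map-tabulate id f)) (sum-tabulate≡sumᶠ n f)

sumBelow : ℕ → (ℕ → ℕ) → ℕ
sumBelow n g = ∑[ i < n ] g (toℕ i)

sumBelow-cong : ∀ n {f g : ℕ → ℕ} → (∀ j → j < n → f j ≡ g j) → sumBelow n f ≡ sumBelow n g
sumBelow-cong zero    f≡g = refl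
sumBelow-cong (suc n) f≡g =
  cong₂ _+_ (f≡g 0 (s≤s z≤n)) (sumBelow-cong n (λ j j<n → f≡g (suc j) (s≤s j<n)))

sumBelow-const : ∀ n c → sumBelow n (λ _ → c) ≡ n * c
sumBelow-const zero    c = refl
sumBelow-const (suc n) c = cong (c +_) (sumBelow-const n c)

sumBelow-+ : ∀ n (f g : ℕ → ℕ) → sumBelow n (λ i → f i + g i) ≡ sumBelow n f + sumBelow n g
sumBelow-+ n f g = ∑-distrib-+ {n} (λ i → f (toℕ i)) (λ i → g (toℕ i))

sumBelow-split : ∀ a b (g : ℕ → ℕ) → sumBelow (a + b) g ≡ sumBelow a g + sumBelow b (λ j → g (a + j))
sumBelow-split zero    b g = refl
sumBelow-split (suc a) b g =
  trans (cong (g 0 +_) (sumBelow-split a b (λ j → g (suc j)))) (sym (+-assoc (g 0) _ _))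

sumBelow-snoc : ∀ n (g : ℕ → ℕ) → sumBelow (suc n) g ≡ sumBelow n g + g n
sumBelow-snoc zero    g = +-comm (g 0) 0
sumBelow-snoc (suc n) g =
  trans (cong (g 0 +_) (sumBelow-snoc n (λ j → g (suc j)))) (sym (+-assoc (g 0) _ _))

sumBelow-mono : ∀ {m n} (g : ℕ → ℕ) → m ≤ n → sumBelow m g ≤ sumBelow n g
sumBelow-mono g z≤n       = z≤n
sumBelow-mono g (s≤s m≤n) = +-monoʳ-≤ (g 0) (sumBelow-mono (λ j → g (suc j)) m≤n)

sumBelow-≤ : ∀ n {f g : ℕ → ℕ} → (∀ j → j < n → f j ≤ g j) → sumBelow n f ≤ sumBelow n g
sumBelow-≤ zero    f≤g = z≤n
sumBelow-≤ (suc n) f≤g = +-mono-≤ (f≤g 0 (s≤s z≤n)) (sumBelow-≤ n (λ j j<n → f≤g (suc j) (s≤s j<n)))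

count : ℕ → (ℕ → Bool) → ℕ
count n P = sumBelow n (λ j → indicator (P j))

count-cong : ∀ n {P Q : ℕ → Bool} → (∀ j → j < n → P j ≡ Q j) → count n P ≡ count n Q
count-cong n P≡Q = sumBelow-cong n (λ j j<n → cong indicator (P≡Q j j<n))

count-none : ∀ n {P : ℕ → Bool} → (∀ j → j < n → P j ≡ false) → count n P ≡ 0
count-none n none = trans (count-cong n none) (sum-replicate-zero n)

indicator-∨ : ∀ a b → (a ∧ b) ≡ false → indicator (a ∨ b) ≡ indicator a + indicator b
indicator-∨ true  false _ = refl
indicator-∨ true  true  ()
indicator-∨ false b     _ = refl

count-∨ : ∀ n (P Q : ℕ → Bool) → (∀ j → j < n → (P j ∧ Q j) ≡ false) →
  count n (λ j → P j ∨ Q j) ≡ count n P + count n Q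
count-∨ n P Q disjoint =
  trans (sumBelow-cong n (λ j j<n → indicator-∨ (P j) (Q j) (disjoint j j<n)))
        (sumBelow-+ n (λ j → indicator (P j)) (λ j → indicator (Q j)))

count-≡ᵇ : ∀ n a → a < n → count n (_≡ᵇ a) ≡ 1
count-≡ᵇ (suc n) zero    _         = cong suc (count-none n (λ j _ → refl))
count-≡ᵇ (suc n) (suc a) (s≤s a<n) = count-≡ᵇ n a a<n

count-≡ᵇ-pair : ∀ n p q → p < n → q < n → p ≢ q → count n (λ j → (j ≡ᵇ p) ∨ (j ≡ᵇ q)) ≡ 2
count-≡ᵇ-pair n p q p<n q<n p≢q =
  trans (count-∨ n (_≡ᵇ p) (_≡ᵇ q) disjoint) (cong₂ _+_ (count-≡ᵇ n p p<n) (count-≡ᵇ n q q<n))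
  where
  disjoint : ∀ j → j < n → ((j ≡ᵇ p) ∧ (j ≡ᵇ q)) ≡ false
  disjoint j _ = ¬-not λ e →
    p≢q (trans (sym (≡ᵇ-true⇒≡ j p (∧-conicalˡ _ _ e))) (≡ᵇ-true⇒≡ j q (∧-conicalʳ _ _ e)))

count-split : ∀ a b (P : ℕ → Bool) → count (a + b) P ≡ count a P + count b (λ j → P (a + j))
count-split a b P = sumBelow-split a b (λ j → indicator (P j))

count-<ᵇ : ∀ n c → c ≤ n → count n (_<ᵇ c) ≡ c
count-<ᵇ n       zero    _         = count-none n (λ j _ → refl)
count-<ᵇ (suc n) (suc c) (s≤s c≤n) = cong suc (count-<ᵇ n c c≤n)

inInterval : ℕ → ℕ → ℕ → Bool
inInterval a b j = not (j <ᵇ a) ∧ (j <ᵇ b)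

inInterval⇒ : ∀ a b j → inInterval a b j ≡ true → (a ≤ j) × (j < b)
inInterval⇒ a b j e = <ᵇ-false⇒≥ (not-injective (∧-conicalˡ _ _ e)) , <ᵇ-true⇒< j b (∧-conicalʳ _ _ e)

inInterval-intro : ∀ {a b j} → a ≤ j → j < b → inInterval a b j ≡ true
inInterval-intro a≤j j<b rewrite ≥⇒<ᵇ-false a≤j | <⇒<ᵇ-true j<b = refl

inInterval-shift : ∀ k a b w → inInterval (k + a) (k + b) (k + w) ≡ inInterval a b w
inInterval-shift zero    a b w = refl
inInterval-shift (suc k) a b w = inInterval-shift k a b w

count-inInterval : ∀ n a c → a + c ≤ n → count n (inInterval a (a + c)) ≡ c
count-inInterval n       zero    c c≤n       = count-<ᵇ n c c≤n
count-inInterval (suc n) (suc a) c (s≤s a+c≤n) = count-inInterval n a c a+c≤n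

module _ {n : ℕ} (G : Graph n) where
  private
    A = adj G

  degree≡sumᶠ : ∀ i → degree G i ≡ ∑[ j < n ] indicator (A i j)
  degree≡sumᶠ i = sum-map-allFin n _

  edgeCount≡sumᶠ : edgeCount G ≡ ∑[ i < n ] ∑[ j < n ] indicator (A i j ∧ (toℕ i <ᵇ toℕ j))
  edgeCount≡sumᶠ = trans (sum-map-allFin n _) (sum-cong-≗ {n} (λ i → sum-map-allFin n _))

  private
    indicator-adj-split : ∀ i j →
      indicator (A i j) ≡ indicator (A i j ∧ (toℕ i <ᵇ toℕ j)) + indicator (A j i ∧ (toℕ j <ᵇ toℕ i))
    indicator-adj-split i j with A i j in e
    ... | false = cong (λ b → indicator (b ∧ (toℕ j <ᵇ toℕ i))) (sym (trans (Graph.sym G j i) e))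
    ... | true with <-cmp (toℕ i) (toℕ j)
    ...   | tri< i<j _ _ rewrite <⇒<ᵇ-true i<j | ≥⇒<ᵇ-false (<⇒≤ i<j) | Graph.sym G j i | e = refl
    ...   | tri> _ _ j<i rewrite <⇒<ᵇ-true j<i | ≥⇒<ᵇ-false (<⇒≤ j<i) | Graph.sym G j i | e = refl
    ...   | tri≈ _ i≡j _ with toℕ-injective i≡j
    ...     | refl = ⊥-elim (false≢true (trans (sym (irrefl G i)) e))

  handshake : ∑[ i < n ] degree G i ≡ edgeCount G + edgeCount G
  handshake = begin
      ∑[ i < n ] degree G i
    ≡⟨ sum-cong-≗ {n} (λ i → trans (degree≡sumᶠ i)
                                   (trans (sum-cong-≗ {n} (indicator-adj-split i)) (∑-distrib-+ {n} _ _))) ⟩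
      ∑[ i < n ] (∑[ j < n ] below i j + ∑[ j < n ] below j i)
    ≡⟨ ∑-distrib-+ {n} _ _ ⟩
      E + ∑[ i < n ] ∑[ j < n ] below j i
    ≡⟨ cong (E +_) (∑-comm {n} {n} (λ i j → below j i)) ⟩
      E + E
    ≡⟨ sym (cong₂ _+_ edgeCount≡sumᶠ edgeCount≡sumᶠ) ⟩
      edgeCount G + edgeCount G
    ∎
    where
    open ≡-Reasoning
    below : Fin n → Fin n → ℕ
    below i j = indicator (A i j ∧ (toℕ i <ᵇ toℕ j))
    E : ℕ
    E = ∑[ i < n ] ∑[ j < n ] below i j

  reach-trans : ∀ {i j k} → Reach G i j → Reach G j k → Reach G i k
  reach-trans here       r′ = r′
  reach-trans (step e r) r′ = step e (reach-trans r r′)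

  reach-sym : ∀ {i j} → Reach G i j → Reach G j i
  reach-sym here       = here
  reach-sym (step e r) = reach-trans (reach-sym r) (step (trans (Graph.sym G _ _) e) here)

  adjacent⇒1≤degree : ∀ i j → A i j ≡ true → 1 ≤ degree G i
  adjacent⇒1≤degree i j e = subst (1 ≤_) (sym (degree≡sumᶠ i))
    (≤-trans (≤-reflexive (cong indicator (sym e))) (term≤sumᶠ n (λ j → indicator (A i j)) j))

  1≤degree⇒neighbour : ∀ i → 1 ≤ degree G i → ∃[ j ] (A i j ≡ true)
  1≤degree⇒neighbour i 1≤deg with any? (λ j → A i j ≟𝔹 true)
  ... | yes found = found
  ... | no none = ⊥-elim (1+n≰n (≤-trans 1≤deg (≤-reflexive (trans (degree≡sumᶠ i)
          (trans (sum-cong-≗ {n} (λ j → cong indicator (¬-not (λ e → none (j , e))))) (sum-replicate-zero n))))))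

  degree+1≤n : ∀ x → degree G x + 1 ≤ n
  degree+1≤n x = subst (_≤ n) sum≡ (sumᶠ-≤1⇒≤n n f f≤1)
    where
    f : Fin n → ℕ
    f j = indicator (A x j) + δ x j
    f≤1 : ∀ j → f j ≤ 1
    f≤1 j with j ≟F x
    ... | yes refl rewrite irrefl G j = s≤s z≤n
    ... | no _ = subst (_≤ 1) (sym (+-identityʳ _)) (indicator≤1 _)
    sum≡ : ∑[ j < n ] f j ≡ degree G x + 1
    sum≡ = trans (∑-distrib-+ {n} _ _) (cong₂ _+_ (sym (degree≡sumᶠ x)) (sumᶠ-δ n x))

  degree+3≤n : ∀ x u v → x ≢ u → x ≢ v → u ≢ v → A x u ≡ false → A x v ≡ false →
    degree G x + 3 ≤ n
  degree+3≤n x u v x≢u x≢v u≢v ¬xu ¬xv = subst (_≤ n) sum≡ (sumᶠ-≤1⇒≤n n f f≤1)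
    where
    f : Fin n → ℕ
    f j = indicator (A x j) + (δ x j + (δ u j + δ v j))
    f≤1 : ∀ j → f j ≤ 1
    f≤1 j with j ≟F x | j ≟F u | j ≟F v
    ... | yes refl | yes refl | _        = ⊥-elim (x≢u refl)
    ... | yes refl | _        | yes refl = ⊥-elim (x≢v refl)
    ... | _        | yes refl | yes refl = ⊥-elim (u≢v refl)
    ... | yes refl | no _     | no _ rewrite irrefl G j = s≤s z≤n
    ... | no _     | yes refl | no _ rewrite ¬xu = s≤s z≤n
    ... | no _     | no _     | yes refl rewrite ¬xv = s≤s z≤n
    ... | no _     | no _     | no _ = subst (_≤ 1) (sym (+-identityʳ _)) (indicator≤1 _)
    sum≡ : ∑[ j < n ] f j ≡ degree G x + 3
    sum≡ = trans (∑-distrib-+ {n} _ _) (cong₂ _+_ (sym (degree≡sumᶠ x))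
      (trans (∑-distrib-+ {n} _ _) (cong₂ _+_ (sumᶠ-δ n x)
        (trans (∑-distrib-+ {n} _ _) (cong₂ _+_ (sumᶠ-δ n u) (sumᶠ-δ n v))))))

  commonNeighbour : ∀ u v → u ≢ v → A u v ≡ false → n < degree G u + degree G v + 2 →
    ∃[ w ] ((A u w ≡ true) × (A v w ≡ true))
  commonNeighbour u v u≢v ¬uv n<sum with any? (λ w → (A u w ∧ A v w) ≟𝔹 true)
  ... | yes (w , e) = w , ∧-conicalˡ _ _ e , ∧-conicalʳ _ _ e
  ... | no none = ⊥-elim (<⇒≱ n<sum (subst (_≤ n) sum≡ (sumᶠ-≤1⇒≤n n f f≤1)))
    where
    ¬vu : A v u ≡ false
    ¬vu = trans (Graph.sym G v u) ¬uv
    f : Fin n → ℕ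
    f j = indicator (A u j) + (indicator (A v j) + (δ u j + δ v j))
    f≤1 : ∀ j → f j ≤ 1
    f≤1 j with j ≟F u | j ≟F v
    ... | yes refl | yes refl = ⊥-elim (u≢v refl)
    ... | yes refl | no _ rewrite irrefl G j | ¬vu = s≤s z≤n
    ... | no _     | yes refl rewrite irrefl G j | ¬uv = s≤s z≤n
    ... | no _     | no _ with A u j in e₁ | A v j in e₂
    ...   | true  | true  = ⊥-elim (none (j , subst (λ b → (b ∧ A v j) ≡ true) (sym e₁) e₂))
    ...   | true  | false = s≤s z≤n
    ...   | false | true  = s≤s z≤n
    ...   | false | false = z≤n
    sum≡ : ∑[ j < n ] f j ≡ degree G u + degree G v + 2
    sum≡ = trans (∑-distrib-+ {n} _ _) (trans (cong₂ _+_ (sym (degree≡sumᶠ u))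
      (trans (∑-distrib-+ {n} _ _) (cong₂ _+_ (sym (degree≡sumᶠ v))
        (trans (∑-distrib-+ {n} _ _) (cong₂ _+_ (sumᶠ-δ n u) (sumᶠ-δ n v))))))
      (sym (+-assoc (degree G u) _ _)))

rootedReach⇒Connected : ∀ {n} (G : Graph n) (r : Fin n) → (∀ v → Reach G v r) → Connected G
rootedReach⇒Connected {suc n} G r reach = s≤s z≤n , λ i j → reach-trans G (reach i) (reach-sym G (reach j))

-- Realizations given by adjacency formulas on ℕ

-- Vertices are 0 … n-1; the adjacency test may relate larger numbers, which are simply ignored.
record Realization (n : ℕ) (d : ℕ → ℕ) : Set where
  field
    adjacency   : ℕ → ℕ → Bool
    symmetric   : ∀ i j → adjacency i j ≡ adjacency j i
    irreflexive : ∀ i → adjacency i i ≡ false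
    degree≡     : ∀ v → v < n → count n (adjacency v) ≡ d v
open Realization

-- Edges never change the label, so vertices with different labels lie in different components.
record DisconnectedRealization (n : ℕ) (d : ℕ → ℕ) : Set where
  field
    realization : Realization n d
    label       : ℕ → Bool
    label-edge  : ∀ i j → adjacency realization i j ≡ true → label i ≡ label j
    p q         : ℕ
    p<n         : p < n
    q<n         : q < n
    label-p≢q   : label p ≢ label q
open DisconnectedRealization

graphOf : ∀ {n d} → Realization n d → Graph n
graphOf R = record
  { adj    = λ i j → adjacency R (toℕ i) (toℕ j)
  ; sym    = λ i j → symmetric R (toℕ i) (toℕ j)
  ; irrefl = λ i → irreflexive R (toℕ i)
  }

graphOf-degree : ∀ {n d} (R : Realization n d) i → degree (graphOf R) i ≡ d (toℕ i)
graphOf-degree {n} R i =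
  trans (sum-map-allFin n _) (degree≡ R (toℕ i) (toℕ<n i))

graphOf-¬Connected : ∀ {n d} (R : DisconnectedRealization n d) → ¬ Connected (graphOf (realization R))
graphOf-¬Connected R (_ , connected) = label-p≢q R (subst₂ (λ x y → label R x ≡ label R y)
  (toℕ-fromℕ< (p<n R)) (toℕ-fromℕ< (q<n R)) (labels (connected (fromℕ< (p<n R)) (fromℕ< (q<n R)))))
  where
  labels : ∀ {i j} → Reach (graphOf (realization R)) i j → label R (toℕ i) ≡ label R (toℕ j)
  labels here       = refl
  labels (step e r) = trans (label-edge R _ _ e) (labels r)

Realization-cast : ∀ {n m d d′} → n ≡ m → (∀ v → v < m → d v ≡ d′ v) → Realization n d → Realization m d′
Realization-cast refl d≡d′ R = record
  { adjacency   = adjacency R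
  ; symmetric   = symmetric R
  ; irreflexive = irreflexive R
  ; degree≡     = λ v v<n → trans (degree≡ R v v<n) (d≡d′ v v<n)
  }

DisconnectedRealization-cast : ∀ {n m d d′} → n ≡ m → (∀ v → v < m → d v ≡ d′ v) →
  DisconnectedRealization n d → DisconnectedRealization m d′
DisconnectedRealization-cast refl d≡d′ R = record
  { realization = Realization-cast refl d≡d′ (realization R)
  ; label = label R ; label-edge = label-edge R
  ; p = p R ; q = q R ; p<n = p<n R ; q<n = q<n R
  ; label-p≢q = label-p≢q R
  }

swap12 : ℕ → ℕ
swap12 1 = 2
swap12 2 = 1
swap12 v = v

swap12-involutive : ∀ v → swap12 (swap12 v) ≡ v
swap12-involutive 0 = refl
swap12-involutive 1 = refl
swap12-involutive 2 = refl
swap12-involutive (suc (suc (suc v))) = refl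

swap12-< : ∀ {n} → 3 ≤ n → ∀ v → v < n → swap12 v < n
swap12-< 3≤n 0 v<n = v<n
swap12-< 3≤n 1 v<n = 3≤n
swap12-< 3≤n 2 v<n = ≤-trans (s≤s (s≤s z≤n)) 3≤n
swap12-< 3≤n (suc (suc (suc v))) v<n = v<n

sumBelow-swap12 : ∀ n (g : ℕ → ℕ) → 3 ≤ n → sumBelow n (λ j → g (swap12 j)) ≡ sumBelow n g
sumBelow-swap12 (suc (suc (suc n))) g _ = cong (g 0 +_)
  (trans (sym (+-assoc (g 2) (g 1) rest)) (trans (cong (_+ rest) (+-comm (g 2) (g 1))) (+-assoc (g 1) (g 2) rest)))
  where rest = sumBelow n (λ j → g (3 + j))
sumBelow-swap12 1 g (s≤s ())
sumBelow-swap12 2 g (s≤s (s≤s ()))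

Realization-swap12 : ∀ {n d} → 3 ≤ n → Realization n (λ v → d (swap12 v)) → Realization n d
Realization-swap12 {n} {d} 3≤n R = record
  { adjacency   = λ i j → adjacency R (swap12 i) (swap12 j)
  ; symmetric   = λ i j → symmetric R (swap12 i) (swap12 j)
  ; irreflexive = λ i → irreflexive R (swap12 i)
  ; degree≡     = λ v v<n → trans (sumBelow-swap12 n (λ j → indicator (adjacency R (swap12 v) j)) 3≤n)
                     (trans (degree≡ R (swap12 v) (swap12-< 3≤n v v<n)) (cong d (swap12-involutive v)))
  }

DisconnectedRealization-swap12 : ∀ {n d} → 3 ≤ n →
  DisconnectedRealization n (λ v → d (swap12 v)) → DisconnectedRealization n d
DisconnectedRealization-swap12 3≤n R = record
  { realization = Realization-swap12 3≤n (realization R)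
  ; label       = λ i → label R (swap12 i)
  ; label-edge  = λ i j → label-edge R (swap12 i) (swap12 j)
  ; p = swap12 (p R) ; q = swap12 (q R)
  ; p<n = swap12-< 3≤n _ (p<n R) ; q<n = swap12-< 3≤n _ (q<n R)
  ; label-p≢q = λ e → label-p≢q R (subst₂ (λ a b → label R a ≡ label R b)
                        (swap12-involutive (p R)) (swap12-involutive (q R)) e)
  }

module Cycle (a L : ℕ) (a+2≤L : a + 2 ≤ L) where

  next : ℕ → ℕ
  next i = if i ≡ᵇ L then a else suc i

  prev : ℕ → ℕ
  prev v = if v ≡ᵇ a then L else pred v

  onCycle : ℕ → Bool
  onCycle = inInterval a (suc L)

  cycle : ℕ → ℕ → Bool
  cycle i j = onCycle i ∧ (onCycle j ∧ ((j ≡ᵇ next i) ∨ (i ≡ᵇ next j)))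

  onCycle-intro : ∀ {i} → a ≤ i → i ≤ L → onCycle i ≡ true
  onCycle-intro a≤i i≤L = inInterval-intro a≤i (s≤s i≤L)

  onCycle⇒ : ∀ {i} → onCycle i ≡ true → (a ≤ i) × (i ≤ L)
  onCycle⇒ {i} e with inInterval⇒ a (suc L) i e
  ... | a≤i , i<1+L = a≤i , ≤-pred i<1+L

  private
    a<L : a < L
    a<L = ≤-trans (≤-reflexive (+-comm 1 a)) (≤-trans (+-monoʳ-≤ a (s≤s z≤n)) a+2≤L)

    suc-pred-above : ∀ {v} → a < v → suc (pred v) ≡ v
    suc-pred-above {suc v} _ = refl

    next-cases : ∀ i → ((i ≡ L) × (next i ≡ a)) ⊎ ((i ≢ L) × (next i ≡ suc i))
    next-cases i with i ≡ᵇ L in e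
    ... | true  = inj₁ (≡ᵇ-true⇒≡ i L e , refl)
    ... | false = inj₂ ((λ { refl → false≢true (trans (sym e) (≡ᵇ-refl i)) }) , refl)

    prev-cases : ∀ v → ((v ≡ a) × (prev v ≡ L)) ⊎ ((v ≢ a) × (prev v ≡ pred v))
    prev-cases v with v ≡ᵇ a in e
    ... | true  = inj₁ (≡ᵇ-true⇒≡ v a e , refl)
    ... | false = inj₂ ((λ { refl → false≢true (trans (sym e) (≡ᵇ-refl v)) }) , refl)

    next≢self : ∀ i → a ≤ i → i ≢ next i
    next≢self i a≤i i≡next with next-cases i
    ... | inj₁ (i≡L , next≡a) = <-irrefl refl (≤-trans a<L (≤-reflexive (trans (sym i≡L) (trans i≡next next≡a))))
    ... | inj₂ (_ , next≡1+i) = <-irrefl (trans i≡next next≡1+i) (n<1+n i)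

    next-range : ∀ v → a ≤ v → v ≤ L → (a ≤ next v) × (next v ≤ L)
    next-range v a≤v v≤L with next-cases v
    ... | inj₁ (_ , e)   rewrite e = ≤-refl , <⇒≤ a<L
    ... | inj₂ (v≢L , e) rewrite e = ≤-trans a≤v (n≤1+n v) , ≤∧≢⇒< v≤L v≢L

    prev-range : ∀ v → a ≤ v → v ≤ L → (a ≤ prev v) × (prev v ≤ L)
    prev-range v a≤v v≤L with prev-cases v
    ... | inj₁ (_ , e)   rewrite e = <⇒≤ a<L , ≤-refl
    ... | inj₂ (v≢a , e) rewrite e = ≤-pred (subst (a <_) (sym (suc-pred-above a<v)) a<v) , ≤-trans pred[n]≤n v≤L
      where a<v = ≤∧≢⇒< a≤v (λ a≡v → v≢a (sym a≡v))

    next≡⇒≡prev : ∀ v j → a ≤ j → v ≡ next j → j ≡ prev v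
    next≡⇒≡prev v j a≤j v≡next with next-cases j | prev-cases v
    ... | inj₁ (j≡L , _)      | inj₁ (_ , prev≡L)     = trans j≡L (sym prev≡L)
    ... | inj₁ (_ , next≡a)   | inj₂ (v≢a , _)        = ⊥-elim (v≢a (trans v≡next next≡a))
    ... | inj₂ (_ , next≡1+j) | inj₁ (v≡a , _)        =
      ⊥-elim (1+n≰n (≤-trans (≤-reflexive (trans (sym (trans v≡next next≡1+j)) v≡a)) a≤j))
    ... | inj₂ (_ , next≡1+j) | inj₂ (_ , prev≡pred) = sym (trans prev≡pred (cong pred (trans v≡next next≡1+j)))

    next-prev : ∀ v → a ≤ v → v ≤ L → v ≡ next (prev v)
    next-prev v a≤v v≤L with prev-cases v
    ... | inj₁ (v≡a , e) rewrite e | ≡ᵇ-refl L = v≡a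
    ... | inj₂ (v≢a , e) rewrite e with next-cases (pred v)
    ...   | inj₁ (pred≡L , _) =
      ⊥-elim (<-irrefl refl (≤-trans (s≤s (≤-reflexive (sym pred≡L))) (≤-trans (≤-reflexive (suc-pred-above a<v)) v≤L)))
      where a<v = ≤∧≢⇒< a≤v (λ a≡v → v≢a (sym a≡v))
    ...   | inj₂ (_ , next≡) = sym (trans next≡ (suc-pred-above (≤∧≢⇒< a≤v (λ a≡v → v≢a (sym a≡v)))))

    m+2≤n⇒m≢pred-n : ∀ m n → m + 2 ≤ n → m ≢ pred n
    m+2≤n⇒m≢pred-n m (suc n) m+2≤n refl = 1+n≰n (≤-pred (≤-trans (≤-reflexive (+-comm 2 m)) m+2≤n))

    m+2≤n⇒1+m≢n : ∀ m n → m + 2 ≤ n → suc m ≢ n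
    m+2≤n⇒1+m≢n m n m+2≤n refl = 1+n≰n (≤-trans (≤-reflexive (+-comm 2 m)) m+2≤n)

    1+n≢pred-n : ∀ v → suc v ≢ pred v
    1+n≢pred-n zero    ()
    1+n≢pred-n (suc v) e = 1+n≰n (≤-trans (n≤1+n (suc v)) (≤-reflexive e))

    next≢prev : ∀ v → next v ≢ prev v
    next≢prev v next≡prev with next-cases v | prev-cases v
    ... | inj₁ (v≡L , _)        | inj₁ (v≡a , _)        = <-irrefl (trans (sym v≡a) v≡L) a<L
    ... | inj₁ (v≡L , next≡a)   | inj₂ (_ , prev≡pred)  =
      m+2≤n⇒m≢pred-n a L a+2≤L (trans (sym next≡a) (trans next≡prev (trans prev≡pred (cong pred v≡L))))
    ... | inj₂ (_ , next≡1+v)   | inj₁ (v≡a , prev≡L)   =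
      m+2≤n⇒1+m≢n a L a+2≤L (trans (cong suc (sym v≡a)) (trans (sym next≡1+v) (trans next≡prev prev≡L)))
    ... | inj₂ (_ , next≡1+v)   | inj₂ (_ , prev≡pred)  =
      1+n≢pred-n v (trans (sym next≡1+v) (trans next≡prev prev≡pred))

  cycle-sym : ∀ i j → cycle i j ≡ cycle j i
  cycle-sym i j with onCycle i | onCycle j
  ... | true  | true  = ∨-comm (j ≡ᵇ next i) (i ≡ᵇ next j)
  ... | true  | false = refl
  ... | false | true  = refl
  ... | false | false = refl

  cycle-irreflexive : ∀ i → cycle i i ≡ false
  cycle-irreflexive i with onCycle i in e
  ... | false = refl
  ... | true  = ¬-not λ e′ → [ (λ x → next≢self i a≤i (≡ᵇ-true⇒≡ i (next i) x))
                             , (λ x → next≢self i a≤i (≡ᵇ-true⇒≡ i (next i) x)) ]′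
                             (∨-true⇒⊎ _ _ e′)
    where a≤i = proj₁ (onCycle⇒ e)

  cycle⇒onCycleˡ : ∀ i j → cycle i j ≡ true → (a ≤ i) × (i ≤ L)
  cycle⇒onCycleˡ i j e = onCycle⇒ (∧-conicalˡ (onCycle i) _ e)

  cycle⇒onCycleʳ : ∀ i j → cycle i j ≡ true → (a ≤ j) × (j ≤ L)
  cycle⇒onCycleʳ i j e = onCycle⇒ (∧-conicalˡ (onCycle j) _ (∧-conicalʳ (onCycle i) _ e))

  cycle-neighbours : ∀ v j → a ≤ v → v ≤ L → cycle v j ≡ ((j ≡ᵇ next v) ∨ (j ≡ᵇ prev v))
  cycle-neighbours v j a≤v v≤L rewrite onCycle-intro a≤v v≤L = ≡true⇔≡true⇒≡ _ _ to from
    where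
    to : (onCycle j ∧ ((j ≡ᵇ next v) ∨ (v ≡ᵇ next j))) ≡ true → ((j ≡ᵇ next v) ∨ (j ≡ᵇ prev v)) ≡ true
    to e with ∨-true⇒⊎ _ _ (∧-conicalʳ (onCycle j) _ e)
    ... | inj₁ j≡next = ≡⊎⇒≡ᵇ-true⊎ j _ _ (inj₁ (≡ᵇ-true⇒≡ j _ j≡next))
    ... | inj₂ v≡next = ≡⊎⇒≡ᵇ-true⊎ j _ _ (inj₂ (next≡⇒≡prev v j (proj₁ (onCycle⇒ (∧-conicalˡ _ _ e)))
                                                                (≡ᵇ-true⇒≡ v _ v≡next)))
    from : ((j ≡ᵇ next v) ∨ (j ≡ᵇ prev v)) ≡ true → (onCycle j ∧ ((j ≡ᵇ next v) ∨ (v ≡ᵇ next j))) ≡ true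
    from e with ≡ᵇ-true⊎⇒≡⊎ j _ _ e
    ... | inj₁ refl rewrite onCycle-intro (proj₁ (next-range v a≤v v≤L)) (proj₂ (next-range v a≤v v≤L))
                          | ≡ᵇ-refl (next v) = refl
    ... | inj₂ refl rewrite onCycle-intro (proj₁ (prev-range v a≤v v≤L)) (proj₂ (prev-range v a≤v v≤L))
                          | sym (next-prev v a≤v v≤L) | ≡ᵇ-refl v = ∨-zeroʳ _

  cycle⇒next⊎prev : ∀ v j → cycle v j ≡ true → (j ≡ next v) ⊎ (j ≡ prev v)
  cycle⇒next⊎prev v j e with cycle⇒onCycleˡ v j e
  ... | a≤v , v≤L = ≡ᵇ-true⊎⇒≡⊎ j (next v) (prev v) (trans (sym (cycle-neighbours v j a≤v v≤L)) e)

  cycle-degree : ∀ N v → L < N → a ≤ v → v ≤ L → count N (cycle v) ≡ 2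
  cycle-degree N v L<N a≤v v≤L = trans (count-cong N (λ j _ → cycle-neighbours v j a≤v v≤L))
    (count-≡ᵇ-pair N _ _ (≤-trans (s≤s (proj₂ (next-range v a≤v v≤L))) L<N)
                         (≤-trans (s≤s (proj₂ (prev-range v a≤v v≤L))) L<N) (next≢prev v))

  cycle-degree-off : ∀ N v → ¬ ((a ≤ v) × (v ≤ L)) → count N (cycle v) ≡ 0
  cycle-degree-off N v off = count-none N (λ j _ → ¬-not λ e → off (cycle⇒onCycleˡ v j e))

edge : ℕ → ℕ → ℕ → ℕ → Bool
edge p q i j = ((i ≡ᵇ p) ∧ (j ≡ᵇ q)) ∨ ((i ≡ᵇ q) ∧ (j ≡ᵇ p))

edge-sym : ∀ p q i j → edge p q i j ≡ edge p q j i
edge-sym p q i j rewrite ∧-comm (i ≡ᵇ p) (j ≡ᵇ q) | ∧-comm (i ≡ᵇ q) (j ≡ᵇ p) =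
  ∨-comm ((j ≡ᵇ q) ∧ (i ≡ᵇ p)) ((j ≡ᵇ p) ∧ (i ≡ᵇ q))

edge⇒endpoints : ∀ p q i j → edge p q i j ≡ true → ((i ≡ p) × (j ≡ q)) ⊎ ((i ≡ q) × (j ≡ p))
edge⇒endpoints p q i j e with ∨-true⇒⊎ _ _ e
... | inj₁ e₁ = inj₁ (≡ᵇ-true⇒≡ i p (∧-conicalˡ _ _ e₁) , ≡ᵇ-true⇒≡ j q (∧-conicalʳ _ _ e₁))
... | inj₂ e₂ = inj₂ (≡ᵇ-true⇒≡ i q (∧-conicalˡ _ _ e₂) , ≡ᵇ-true⇒≡ j p (∧-conicalʳ _ _ e₂))

edge-irreflexive : ∀ p q → p ≢ q → ∀ i → edge p q i i ≡ false
edge-irreflexive p q p≢q i = ¬-not λ e → [ (λ { (refl , refl) → p≢q refl }) , (λ { (refl , refl) → p≢q refl }) ]′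
                                            (edge⇒endpoints p q i i e)

edge-degree : ∀ N p q v → p < N → q < N → p ≢ q →
  count N (edge p q v) ≡ indicator (v ≡ᵇ p) + indicator (v ≡ᵇ q)
edge-degree N p q v p<N q<N p≢q with v ≡ᵇ p in e₁ | v ≡ᵇ q in e₂
... | true  | true  = ⊥-elim (p≢q (trans (sym (≡ᵇ-true⇒≡ v p e₁)) (≡ᵇ-true⇒≡ v q e₂)))
... | true  | false = trans (count-cong N {Q = _≡ᵇ q} (λ j _ → ∨-identityʳ _)) (count-≡ᵇ N q q<N)
... | false | true  = count-≡ᵇ N p p<N
... | false | false = count-none N (λ j _ → refl)

infixr 5 _∪_
_∪_ : (ℕ → ℕ → Bool) → (ℕ → ℕ → Bool) → ℕ → ℕ → Bool
(A ∪ B) i j = A i j ∨ B i j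

∪-sym : ∀ A B → (∀ i j → A i j ≡ A j i) → (∀ i j → B i j ≡ B j i) → ∀ i j → (A ∪ B) i j ≡ (A ∪ B) j i
∪-sym _ _ A-sym B-sym i j = cong₂ _∨_ (A-sym i j) (B-sym i j)

∪-irreflexive : ∀ A B → (∀ i → A i i ≡ false) → (∀ i → B i i ≡ false) → ∀ i → (A ∪ B) i i ≡ false
∪-irreflexive _ _ A-irr B-irr i = cong₂ _∨_ (A-irr i) (B-irr i)

module Pendants {K : ℕ} {h : ℕ → ℕ} (core : Realization K h)
                (core-support : ∀ i j → adjacency core i j ≡ true → j < K) (x : ℕ → ℕ) where

  private
    C = adjacency core
    M = sumBelow K x
    N = K + M

    -- The x i pendant vertices of core vertex i are K + offset i, …, K + offset i + x i - 1.
    offset : ℕ → ℕ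
    offset i = sumBelow i x

    pendant : ℕ → ℕ → Bool
    pendant i j = (i <ᵇ K) ∧ inInterval (K + offset i) (K + offset i + x i) j

    withPendants : ℕ → ℕ → Bool
    withPendants = C ∪ pendant ∪ (λ i j → pendant j i)

    pendant⇒ : ∀ i j → pendant i j ≡ true → (i < K) × (K + offset i ≤ j) × (j < K + offset i + x i)
    pendant⇒ i j e with inInterval⇒ _ _ j (∧-conicalʳ (i <ᵇ K) _ e)
    ... | lo , hi = <ᵇ-true⇒< i K (∧-conicalˡ _ _ e) , lo , hi

    pendant-core : ∀ i j → j < K → pendant i j ≡ false
    pendant-core i j j<K = ¬-not λ e → let (_ , lo , _) = pendant⇒ i j e in
      1+n≰n (≤-trans j<K (≤-trans (m≤m+n K (offset i)) lo))

    pendant-from-pendant : ∀ i j → K ≤ i → pendant i j ≡ false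
    pendant-from-pendant i j K≤i = ¬-not λ e → 1+n≰n (≤-trans (proj₁ (pendant⇒ i j e)) K≤i)

    core-from-pendant : ∀ i j → K ≤ i → C i j ≡ false
    core-from-pendant i j K≤i = ¬-not λ e → 1+n≰n (≤-trans (core-support j i (trans (symmetric core j i) e)) K≤i)

    withPendants-sym : ∀ i j → withPendants i j ≡ withPendants j i
    withPendants-sym i j = cong₂ _∨_ (symmetric core i j) (∨-comm (pendant i j) (pendant j i))

    withPendants-irreflexive : ∀ i → withPendants i i ≡ false
    withPendants-irreflexive i = cong₂ _∨_ (irreflexive core i) (cong₂ _∨_ no-loop no-loop)
      where
      no-loop : pendant i i ≡ false
      no-loop = ¬-not λ e → let (i<K , lo , _) = pendant⇒ i i e in
        1+n≰n (≤-trans i<K (≤-trans (m≤m+n K (offset i)) lo))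

    offset+x≤M : ∀ v → v < K → offset v + x v ≤ M
    offset+x≤M v v<K = ≤-trans (≤-reflexive (sym (sumBelow-snoc v x))) (sumBelow-mono x v<K)

    degree-core : ∀ v → v < K → count N (withPendants v) ≡ h v + x v
    degree-core v v<K = begin
        count N (withPendants v)
      ≡⟨ count-∨ N (C v) (λ j → pendant v j ∨ pendant j v) disjoint ⟩
        count N (C v) + count N (λ j → pendant v j ∨ pendant j v)
      ≡⟨ cong₂ _+_ core-part (count-cong N (λ j _ → trans (cong (pendant v j ∨_) (pendant-core j v v<K))
                                                           (∨-identityʳ _))) ⟩
        h v + count N (pendant v)
      ≡⟨ cong (h v +_) (trans (count-cong N {P = pendant v} {Q = inInterval (K + offset v) (K + offset v + x v)}
                                  (λ j _ → cong (_∧ inInterval (K + offset v) (K + offset v + x v) j)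
                                                (<⇒<ᵇ-true v<K)))
           (count-inInterval N (K + offset v) (x v)
              (≤-trans (≤-reflexive (+-assoc K (offset v) (x v))) (+-monoʳ-≤ K (offset+x≤M v v<K))))) ⟩
        h v + x v
      ∎
      where
      open ≡-Reasoning
      disjoint : ∀ j → j < N → (C v j ∧ (pendant v j ∨ pendant j v)) ≡ false
      disjoint j _ with C v j in e
      ... | false = refl
      ... | true rewrite pendant-core v j (core-support v j e) | pendant-core j v v<K = refl
      core-part : count N (C v) ≡ h v
      core-part = trans (count-split K M (C v))
        (trans (cong₂ _+_ (degree≡ core v v<K)
                 (count-none M (λ j _ → ¬-not λ e → 1+n≰n (≤-trans (core-support v (K + j) e) (m≤m+n K j)))))
               (+-identityʳ _))

    owns : ℕ → ℕ → Bool
    owns j w = inInterval (offset j) (offset j + x j) w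

    owner-unique : ∀ k w → w < sumBelow k x → count k (λ j → owns j w) ≡ 1
    owner-unique (suc k) w w<sum with w <ᵇ sumBelow k x in e
    ... | true = trans (sumBelow-snoc k (λ j → indicator (owns j w)))
                       (cong₂ _+_ (owner-unique k w w<offset) (cong indicator (¬-not not-last)))
      where
      w<offset = <ᵇ-true⇒< w (sumBelow k x) e
      not-last : owns k w ≢ true
      not-last e′ = 1+n≰n (≤-trans w<offset (proj₁ (inInterval⇒ (offset k) (offset k + x k) w e′)))
    ... | false = trans (sumBelow-snoc k (λ j → indicator (owns j w)))
                        (cong₂ _+_ (count-none k earlier) (cong indicator last))
      where
      earlier : ∀ j → j < k → owns j w ≡ false
      earlier j j<k = ¬-not λ e′ → 1+n≰n (≤-trans (proj₂ (inInterval⇒ (offset j) (offset j + x j) w e′))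
        (≤-trans (≤-reflexive (sym (sumBelow-snoc j x)))
                 (≤-trans (sumBelow-mono x j<k) (<ᵇ-false⇒≥ {w} {sumBelow k x} e))))
      last : owns k w ≡ true
      last = inInterval-intro (<ᵇ-false⇒≥ {w} {sumBelow k x} e) (subst (w <_) (sumBelow-snoc k x) w<sum)

    degree-pendant : ∀ v → K ≤ v → v < N → count N (withPendants v) ≡ 1
    degree-pendant v K≤v v<N = begin
        count N (withPendants v)
      ≡⟨ count-cong N (λ j _ → only-incoming j) ⟩
        count N (λ j → pendant j v)
      ≡⟨ count-split K M (λ j → pendant j v) ⟩
        count K (λ j → pendant j v) + count M (λ j → pendant (K + j) v)
      ≡⟨ cong₂ _+_ (count-cong K (λ j j<K → from-core j j<K))
                   (count-none M (λ j _ → pendant-from-pendant (K + j) v (m≤m+n K j))) ⟩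
        count K (λ j → owns j w) + 0
      ≡⟨ cong (_+ 0) (owner-unique K w w<M) ⟩
        1
      ∎
      where
      open ≡-Reasoning
      w = v ∸ K
      v≡K+w : v ≡ K + w
      v≡K+w = sym (m+[n∸m]≡n K≤v)
      w<M : w < M
      w<M = +-cancelˡ-< K w M (subst (_< N) v≡K+w v<N)
      only-incoming : ∀ j → withPendants v j ≡ pendant j v
      only-incoming j rewrite core-from-pendant v j K≤v | pendant-from-pendant v j K≤v = refl
      from-core : ∀ j → j < K → pendant j v ≡ owns j w
      from-core j j<K rewrite <⇒<ᵇ-true j<K =
        trans (cong₂ (inInterval (K + offset j)) (+-assoc K (offset j) (x j)) v≡K+w)
              (inInterval-shift K (offset j) (offset j + x j) w)

  realization-withPendants : ∀ n d → n ≡ N → (∀ v → v < K → d v ≡ h v + x v) →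
    (∀ v → K ≤ v → v < n → d v ≡ 1) → Realization n d
  realization-withPendants n d n≡N d-core d-pendant = record
    { adjacency = withPendants ; symmetric = withPendants-sym ; irreflexive = withPendants-irreflexive
    ; degree≡ = λ v v<n → subst (λ m → count m (withPendants v) ≡ d v) (sym n≡N) (degree≡′ v v<n) }
    where
    degree≡′ : ∀ v → v < n → count N (withPendants v) ≡ d v
    degree≡′ v v<n with v <? K
    ... | yes v<K = trans (degree-core v v<K) (sym (d-core v v<K))
    ... | no v≮K  = trans (degree-pendant v (≮⇒≥ v≮K) (subst (v <_) n≡N v<n)) (sym (d-pendant v (≮⇒≥ v≮K) v<n))

  disconnected-withPendants : ∀ n d → n ≡ N → (∀ v → v < K → d v ≡ h v + x v) →
    (∀ v → K ≤ v → v < n → d v ≡ 1) →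
    (label : ℕ → Bool) → (∀ i j → C i j ≡ true → label i ≡ label j) → (∀ i → K ≤ i → label i ≡ false) →
    (∀ i → i < K → 0 < x i → label i ≡ false) → ∀ p q → p < n → q < n → label p ≢ label q →
    DisconnectedRealization n d
  disconnected-withPendants n d n≡N d-core d-pendant label label-core label-pendant label-owner p q p<n q<n ≢ =
    record { realization = realization-withPendants n d n≡N d-core d-pendant
           ; label = label ; label-edge = label-edge′ ; p = p ; q = q ; p<n = p<n ; q<n = q<n ; label-p≢q = ≢ }
    where
    label-pendant-edge : ∀ i j → pendant i j ≡ true → label i ≡ label j
    label-pendant-edge i j e with pendant⇒ i j e
    ... | i<K , lo , hi =
      trans (label-owner i i<K (+-cancelˡ-< (K + offset i) 0 (x i)
                (≤-trans (≤-reflexive (cong suc (+-identityʳ (K + offset i)))) (≤-trans (s≤s lo) hi))))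
            (sym (label-pendant j (≤-trans (m≤m+n K (offset i)) lo)))
    label-edge′ : ∀ i j → withPendants i j ≡ true → label i ≡ label j
    label-edge′ i j e with ∨-true⇒⊎ _ _ e
    ... | inj₁ e₁ = label-core i j e₁
    ... | inj₂ e₂ with ∨-true⇒⊎ _ _ e₂
    ...   | inj₁ e₃ = label-pendant-edge i j e₃
    ...   | inj₂ e₄ = sym (label-pendant-edge j i e₄)

cycleCore : ∀ K′ → Realization (3 + K′) (λ _ → 2)
cycleCore K′ = record
  { adjacency = cycle ; symmetric = cycle-sym ; irreflexive = cycle-irreflexive
  ; degree≡ = λ v v<K → cycle-degree (3 + K′) v ≤-refl z≤n (≤-pred v<K) }
  where open Cycle 0 (2 + K′) (s≤s (s≤s z≤n))

cycleCore-support : ∀ K′ i j → adjacency (cycleCore K′) i j ≡ true → j < 3 + K′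
cycleCore-support K′ i j e = s≤s (proj₂ (cycle⇒onCycleʳ i j e))
  where open Cycle 0 (2 + K′) (s≤s (s≤s z≤n))

atZero : ℕ → ℕ → ℕ
atZero L 0       = L
atZero L (suc _) = 0

sumBelow-atZero : ∀ k L → sumBelow (suc k) (atZero L) ≡ L
sumBelow-atZero k L = trans (cong (L +_) (sum-replicate-zero k)) (+-identityʳ L)

-- The sequence (L + 2, 2^(K-1), 1^L); cases (1) and (2) are K = 5, L ≤ 1 and K = 4.
hubDegrees : ℕ → ℕ → ℕ → ℕ
hubDegrees L K 0       = 2 + L
hubDegrees L K (suc v) = if suc v <ᵇ K then 2 else 1

hubDegrees-body : ∀ L K v → 1 ≤ v → v < K → hubDegrees L K v ≡ 2
hubDegrees-body L K (suc v) _ v<K rewrite <⇒<ᵇ-true v<K = refl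

hubDegrees-tail : ∀ L K v → K ≤ suc v → hubDegrees L K (suc v) ≡ 1
hubDegrees-tail L K v K≤1+v rewrite ≥⇒<ᵇ-false K≤1+v = refl

hub-realization : ∀ L K′ → Realization (3 + K′ + L) (hubDegrees L (3 + K′))
hub-realization L K′ = realization-withPendants (3 + K′ + L) (hubDegrees L (3 + K′))
  (cong (3 + K′ +_) (sym (sumBelow-atZero (2 + K′) L))) on-cycle leaves
  where
  open Pendants (cycleCore K′) (cycleCore-support K′) (atZero L) using (realization-withPendants)
  on-cycle : ∀ v → v < 3 + K′ → hubDegrees L (3 + K′) v ≡ 2 + atZero L v
  on-cycle 0       _   = refl
  on-cycle (suc v) v<K = hubDegrees-body L (3 + K′) (suc v) (s≤s z≤n) v<K
  leaves : ∀ v → 3 + K′ ≤ v → v < 3 + K′ + L → hubDegrees L (3 + K′) v ≡ 1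
  leaves (suc v) K≤v _ = hubDegrees-tail L (3 + K′) v K≤v

case3Degrees : ℕ → ℕ → ℕ → ℕ → ℕ
case3Degrees r s t 0 = r
case3Degrees r s t 1 = s
case3Degrees r s t 2 = t
case3Degrees r s t (suc (suc (suc _))) = 1

triangle-realization : ∀ r s t → Realization (3 + (r + (s + (t + 0)))) (case3Degrees (2 + r) (2 + s) (2 + t))
triangle-realization r s t =
  realization-withPendants _ _ refl on-triangle leaves
  where
  open Pendants (cycleCore 0) (cycleCore-support 0) (case3Degrees r s t) using (realization-withPendants)
  on-triangle : ∀ v → v < 3 → case3Degrees (2 + r) (2 + s) (2 + t) v ≡ 2 + case3Degrees r s t v
  on-triangle 0 _ = refl
  on-triangle 1 _ = refl
  on-triangle 2 _ = refl
  on-triangle (suc (suc (suc v))) (s≤s (s≤s (s≤s ())))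
  leaves : ∀ v → 3 ≤ v → v < 3 + (r + (s + (t + 0))) → case3Degrees (2 + r) (2 + s) (2 + t) v ≡ 1
  leaves (suc (suc (suc v))) _ _ = refl
  leaves 1 (s≤s ()) _
  leaves 2 (s≤s (s≤s ())) _

-- Disjoint cycles on 0 … k+2 and k+3 … k+5, with L pendant vertices at 0.
module TwoCycles (k L : ℕ) where
  private
    K = 6 + k
    module C₁ = Cycle 0 (2 + k) (s≤s (s≤s z≤n))
    module C₂ = Cycle (3 + k) (5 + k) (≤-reflexive (cong (3 +_) (+-comm k 2)))
    first<K : 3 + k ≤ K
    first<K = +-monoˡ-≤ k {3} {6} (s≤s (s≤s (s≤s z≤n)))
    core : Realization K (λ _ → 2)
    core = record
      { adjacency = C₁.cycle ∪ C₂.cycle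
      ; symmetric = ∪-sym C₁.cycle C₂.cycle C₁.cycle-sym C₂.cycle-sym
      ; irreflexive = ∪-irreflexive C₁.cycle C₂.cycle C₁.cycle-irreflexive C₂.cycle-irreflexive
      ; degree≡ = degree≡′ }
      where
      degree≡′ : ∀ v → v < K → count K ((C₁.cycle ∪ C₂.cycle) v) ≡ 2
      degree≡′ v v<K = trans (count-∨ K (C₁.cycle v) (C₂.cycle v) disjoint) two
        where
        disjoint : ∀ j → j < K → (C₁.cycle v j ∧ C₂.cycle v j) ≡ false
        disjoint j _ = ¬-not λ e → 1+n≰n (≤-trans (s≤s (proj₂ (C₁.cycle⇒onCycleˡ v j (∧-conicalˡ _ _ e))))
                                               (proj₁ (C₂.cycle⇒onCycleˡ v j (∧-conicalʳ (C₁.cycle v j) _ e))))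
        two : count K (C₁.cycle v) + count K (C₂.cycle v) ≡ 2
        two with v ≤? 2 + k
        ... | yes v≤ = cong₂ _+_ (C₁.cycle-degree K v first<K z≤n v≤)
                                 (C₂.cycle-degree-off K v (λ (lo , _) → 1+n≰n (≤-trans lo v≤)))
        ... | no v≰ = cong₂ _+_ (C₁.cycle-degree-off K v (λ (_ , hi) → v≰ hi))
                                (C₂.cycle-degree K v ≤-refl (≰⇒> v≰) (≤-pred v<K))
    core-support : ∀ i j → adjacency core i j ≡ true → j < K
    core-support i j e with ∨-true⇒⊎ _ _ e
    ... | inj₁ e₁ = ≤-trans (s≤s (proj₂ (C₁.cycle⇒onCycleʳ i j e₁))) first<K
    ... | inj₂ e₂ = s≤s (proj₂ (C₂.cycle⇒onCycleʳ i j e₂))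
    open Pendants core core-support (atZero L) using (disconnected-withPendants)
    K+L≡ : K + L ≡ K + sumBelow K (atZero L)
    K+L≡ = cong (K +_) (sym (sumBelow-atZero (5 + k) L))
    on-core : ∀ v → v < K → hubDegrees L K v ≡ 2 + atZero L v
    on-core 0       _   = refl
    on-core (suc v) v<K = hubDegrees-body L K (suc v) (s≤s z≤n) v<K
    leaves : ∀ v → K ≤ v → v < K + L → hubDegrees L K v ≡ 1
    leaves (suc v) K≤v _ = hubDegrees-tail L K v K≤v
    label-core : ∀ i j → adjacency core i j ≡ true → C₂.onCycle i ≡ C₂.onCycle j
    label-core i j e with ∨-true⇒⊎ _ _ e
    ... | inj₁ e₁ = trans (off (proj₂ (C₁.cycle⇒onCycleˡ i j e₁))) (sym (off (proj₂ (C₁.cycle⇒onCycleʳ i j e₁))))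
      where
      off : ∀ {z} → z ≤ 2 + k → C₂.onCycle z ≡ false
      off z≤ = ¬-not λ e → 1+n≰n (≤-trans (proj₁ (C₂.onCycle⇒ e)) z≤)
    ... | inj₂ e₂ = trans (on (C₂.cycle⇒onCycleˡ i j e₂)) (sym (on (C₂.cycle⇒onCycleʳ i j e₂)))
      where
      on : ∀ {z} → (3 + k ≤ z) × (z ≤ 5 + k) → C₂.onCycle z ≡ true
      on (lo , hi) = C₂.onCycle-intro lo hi
    label-leaf : ∀ i → K ≤ i → C₂.onCycle i ≡ false
    label-leaf i K≤i = ¬-not λ e → 1+n≰n (≤-trans K≤i (proj₂ (C₂.onCycle⇒ e)))
    label-owner : ∀ i → i < K → 0 < atZero L i → C₂.onCycle i ≡ false
    label-owner 0 _ _ = refl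

  twoCycles-disconnected : DisconnectedRealization (6 + k + L) (hubDegrees L (6 + k))
  twoCycles-disconnected =
    disconnected-withPendants (K + L) (hubDegrees L K) K+L≡ on-core leaves
      C₂.onCycle label-core label-leaf label-owner 0 (3 + k)
      (s≤s z≤n) (≤-trans (+-monoˡ-≤ k {4} {6} (s≤s (s≤s (s≤s (s≤s z≤n))))) (m≤m+n K L))
      (λ e → false≢true (trans e (C₂.onCycle-intro ≤-refl (+-monoˡ-≤ k {3} {5} (s≤s (s≤s (s≤s z≤n)))))))

-- Triangles 0 1 2 and 0 3 4 sharing vertex 0, the edge 5 6, and L pendant vertices at 0.
module Bowtie (L : ℕ) where
  private
    module Tri = Cycle 0 2 ≤-refl
    bowtie : ℕ → ℕ → Bool
    bowtie = Tri.cycle ∪ edge 0 3 ∪ edge 0 4 ∪ edge 3 4 ∪ edge 5 6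
    data Edge (i j : ℕ) : Set where
      small : i ≤ 4 → j ≤ 4 → Edge i j
      large : i ≡ 5 ⊎ i ≡ 6 → j ≡ 5 ⊎ j ≡ 6 → Edge i j
    edge-kind : ∀ i j → bowtie i j ≡ true → Edge i j
    edge-kind i j e with ∨-true⇒⊎ _ _ e
    ... | inj₁ e₁ = small (≤-trans (proj₂ (Tri.cycle⇒onCycleˡ i j e₁)) (s≤s (s≤s z≤n)))
                          (≤-trans (proj₂ (Tri.cycle⇒onCycleʳ i j e₁)) (s≤s (s≤s z≤n)))
    ... | inj₂ e₂ with ∨-true⇒⊎ _ _ e₂
    ...   | inj₁ e₃ = [ (λ { (refl , refl) → small z≤n 3≤4 }) , (λ { (refl , refl) → small 3≤4 z≤n }) ]′
                        (edge⇒endpoints 0 3 i j e₃)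
      where 3≤4 = n≤1+n 3
    ...   | inj₂ e₄ with ∨-true⇒⊎ _ _ e₄
    ...     | inj₁ e₅ = [ (λ { (refl , refl) → small z≤n ≤-refl }) , (λ { (refl , refl) → small ≤-refl z≤n }) ]′
                          (edge⇒endpoints 0 4 i j e₅)
    ...     | inj₂ e₆ with ∨-true⇒⊎ _ _ e₆
    ...       | inj₁ e₇ = [ (λ { (refl , refl) → small (n≤1+n 3) ≤-refl }) , (λ { (refl , refl) → small ≤-refl (n≤1+n 3) }) ]′
                            (edge⇒endpoints 3 4 i j e₇)
    ...       | inj₂ e₈ = [ (λ { (refl , refl) → large (inj₁ refl) (inj₂ refl) })
                          , (λ { (refl , refl) → large (inj₂ refl) (inj₁ refl) }) ]′ (edge⇒endpoints 5 6 i j e₈)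
    core : Realization 7 (hubDegrees 2 5)
    core = record
      { adjacency = bowtie
      ; symmetric = ∪-sym Tri.cycle (edge 0 3 ∪ edge 0 4 ∪ edge 3 4 ∪ edge 5 6) Tri.cycle-sym
                      (∪-sym (edge 0 3) (edge 0 4 ∪ edge 3 4 ∪ edge 5 6) (edge-sym 0 3)
                      (∪-sym (edge 0 4) (edge 3 4 ∪ edge 5 6) (edge-sym 0 4)
                        (∪-sym (edge 3 4) (edge 5 6) (edge-sym 3 4) (edge-sym 5 6))))
      ; irreflexive = ∪-irreflexive Tri.cycle (edge 0 3 ∪ edge 0 4 ∪ edge 3 4 ∪ edge 5 6) Tri.cycle-irreflexive
                        (∪-irreflexive (edge 0 3) (edge 0 4 ∪ edge 3 4 ∪ edge 5 6) (edge-irreflexive 0 3 λ ())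
                          (∪-irreflexive (edge 0 4) (edge 3 4 ∪ edge 5 6) (edge-irreflexive 0 4 λ ())
                            (∪-irreflexive (edge 3 4) (edge 5 6) (edge-irreflexive 3 4 λ ()) (edge-irreflexive 5 6 λ ()))))
      ; degree≡ = degree≡′ }
      where
      degree≡′ : ∀ v → v < 7 → count 7 (bowtie v) ≡ hubDegrees 2 5 v
      degree≡′ 0 _ = refl
      degree≡′ 1 _ = refl
      degree≡′ 2 _ = refl
      degree≡′ 3 _ = refl
      degree≡′ 4 _ = refl
      degree≡′ 5 _ = refl
      degree≡′ 6 _ = refl
      degree≡′ (suc (suc (suc (suc (suc (suc (suc v))))))) (s≤s (s≤s (s≤s (s≤s (s≤s (s≤s (s≤s ())))))))
    core-support : ∀ i j → bowtie i j ≡ true → j < 7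
    core-support i j e with edge-kind i j e
    ... | small _ j≤4 = ≤-trans (s≤s j≤4) (+-monoʳ-≤ 5 (z≤n {2}))
    ... | large _ (inj₁ refl) = n≤1+n 6
    ... | large _ (inj₂ refl) = ≤-refl
    open Pendants core core-support (atZero L) using (disconnected-withPendants)
    on-core : ∀ v → v < 7 → hubDegrees (2 + L) 5 v ≡ hubDegrees 2 5 v + atZero L v
    on-core 0 _ = refl
    on-core 1 _ = refl
    on-core 2 _ = refl
    on-core 3 _ = refl
    on-core 4 _ = refl
    on-core 5 _ = refl
    on-core 6 _ = refl
    on-core (suc (suc (suc (suc (suc (suc (suc v))))))) (s≤s (s≤s (s≤s (s≤s (s≤s (s≤s (s≤s ())))))))
    leaves : ∀ v → 7 ≤ v → v < 7 + L → hubDegrees (2 + L) 5 v ≡ 1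
    leaves (suc v) 7≤1+v _ = hubDegrees-tail (2 + L) 5 v (≤-trans (n≤1+n 5) (≤-trans (n≤1+n 6) 7≤1+v))
    side : ℕ → Bool
    side i = (i ≡ᵇ 5) ∨ (i ≡ᵇ 6)
    label-small : ∀ i → i ≤ 4 → side i ≡ false
    label-small 0 _ = refl
    label-small 1 _ = refl
    label-small 2 _ = refl
    label-small 3 _ = refl
    label-small 4 _ = refl
    label-small (suc (suc (suc (suc (suc i))))) (s≤s (s≤s (s≤s (s≤s ()))))
    label-large : ∀ i → i ≡ 5 ⊎ i ≡ 6 → side i ≡ true
    label-large _ (inj₁ refl) = refl
    label-large _ (inj₂ refl) = refl
    label-core : ∀ i j → bowtie i j ≡ true → side i ≡ side j
    label-core i j e with edge-kind i j e
    ... | small i≤4 j≤4 = trans (label-small i i≤4) (sym (label-small j j≤4))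
    ... | large i∈ j∈  = trans (label-large i i∈) (sym (label-large j j∈))
    label-leaf : ∀ i → 7 ≤ i → side i ≡ false
    label-leaf i 7≤i = cong₂ _∨_ (≢⇒≡ᵇ-false {i} {5} (λ { refl → 1+n≰n (≤-trans (n≤1+n 6) 7≤i) }))
                                 (≢⇒≡ᵇ-false {i} {6} (λ { refl → 1+n≰n 7≤i }))
    label-owner : ∀ i → i < 7 → 0 < atZero L i → side i ≡ false
    label-owner 0 _ _ = refl

  bowtie-disconnected : DisconnectedRealization (7 + L) (hubDegrees (2 + L) 5)
  bowtie-disconnected = disconnected-withPendants (7 + L) (hubDegrees (2 + L) 5)
    (cong (7 +_) (sym (sumBelow-atZero 6 L))) on-core leaves side label-core label-leaf label-owner
    0 5 (s≤s z≤n) (≤-trans (n≤1+n 6) (m≤m+n 7 L)) (λ ())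

-- For k = 4 + k′: the cycle 0 … k-1 with the chord 0 2 and the disjoint edge k (k+1).  Vertices 1 and 2
-- are swapped at the end so that the chord ends carry the two largest terms d 0 and d 1.
module ChordedCycle (k′ n : ℕ) (d : ℕ → ℕ) (6+k′≤n : 6 + k′ ≤ n) (3≤d0 : 3 ≤ d 0) (3≤d1 : 3 ≤ d 1)
                    (large : ∀ v → v < 4 + k′ → 2 ≤ d v) (leaf : ∀ v → 4 + k′ ≤ v → v < n → d v ≡ 1)
                    (sum-large : sumBelow (4 + k′) d ≡ n + (4 + k′)) where
  private
    k = 4 + k′
    K = 2 + k
    module Z = Cycle 0 (3 + k′) (s≤s (s≤s z≤n))
    k<K : k < K
    k<K = n≤1+n (suc k)
    k≤K : k ≤ K
    k≤K = ≤-trans (n≤1+n k) (n≤1+n (suc k))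
    k≢1+k : k ≢ suc k
    k≢1+k e = <-irrefl e (n<1+n k)

    extra : ℕ → ℕ → Bool
    extra = edge 0 2 ∪ edge k (suc k)

    chordedCycle : ℕ → ℕ → Bool
    chordedCycle = Z.cycle ∪ extra

    data Edge (i j : ℕ) : Set where
      cycle-edge : i < k → j < k → Edge i j
      chord      : (i ≡ 0 × j ≡ 2) ⊎ (i ≡ 2 × j ≡ 0) → Edge i j
      pair       : (i ≡ k × j ≡ suc k) ⊎ (i ≡ suc k × j ≡ k) → Edge i j

    edge-kind : ∀ i j → chordedCycle i j ≡ true → Edge i j
    edge-kind i j e with ∨-true⇒⊎ _ _ e
    ... | inj₁ e₁ = cycle-edge (s≤s (proj₂ (Z.cycle⇒onCycleˡ i j e₁))) (s≤s (proj₂ (Z.cycle⇒onCycleʳ i j e₁)))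
    ... | inj₂ e₂ with ∨-true⇒⊎ _ _ e₂
    ...   | inj₁ e₃ = chord (edge⇒endpoints 0 2 i j e₃)
    ...   | inj₂ e₄ = pair (edge⇒endpoints k (suc k) i j e₄)

    support : ∀ i j → chordedCycle i j ≡ true → j < K
    support i j e with edge-kind i j e
    ... | cycle-edge _ j<k         = ≤-trans j<k k≤K
    ... | chord (inj₁ (_ , refl))  = ≤-trans (s≤s (s≤s (s≤s z≤n))) k≤K
    ... | chord (inj₂ (_ , refl))  = s≤s z≤n
    ... | pair (inj₁ (_ , refl))   = ≤-refl
    ... | pair (inj₂ (_ , refl))   = k<K

    double : Bool → ℕ
    double b = indicator b + indicator b

    coreDegree : ℕ → ℕ
    coreDegree v = double (v <ᵇ k) + ((indicator (v ≡ᵇ 0) + indicator (v ≡ᵇ 2))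
                                      + (indicator (v ≡ᵇ k) + indicator (v ≡ᵇ suc k)))

    cycle-disjoint-extra : ∀ v j → (Z.cycle v j ∧ extra v j) ≡ false
    cycle-disjoint-extra v j = ¬-not absurd
      where
      absurd : (Z.cycle v j ∧ extra v j) ≡ true → ⊥
      absurd e with ∧-conicalˡ (Z.cycle v j) _ e | ∨-true⇒⊎ _ _ (∧-conicalʳ (Z.cycle v j) _ e)
      ... | e₁ | inj₁ e₃ with edge⇒endpoints 0 2 v j e₃
      ...   | inj₁ (refl , refl) with Z.cycle⇒next⊎prev 0 2 e₁
      ...     | inj₁ ()
      ...     | inj₂ ()
      absurd e | e₁ | inj₁ e₃ | inj₂ (refl , refl) with Z.cycle⇒next⊎prev 2 0 e₁
      ...     | inj₁ ()
      ...     | inj₂ ()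
      absurd e | e₁ | inj₂ e₄ =
        [ (λ (v≡k , _)   → 1+n≰n (≤-trans (≤-reflexive (sym v≡k)) (proj₂ (Z.cycle⇒onCycleˡ v j e₁))))
        , (λ (v≡1+k , _) → 1+n≰n (≤-trans (≤-trans (n≤1+n k) (≤-reflexive (sym v≡1+k)))
                                          (proj₂ (Z.cycle⇒onCycleˡ v j e₁)))) ]′
        (edge⇒endpoints k (suc k) v j e₄)

    chord-disjoint-pair : ∀ v j → (edge 0 2 v j ∧ edge k (suc k) v j) ≡ false
    chord-disjoint-pair v j = ¬-not absurd
      where
      absurd : (edge 0 2 v j ∧ edge k (suc k) v j) ≡ true → ⊥
      absurd e with edge⇒endpoints 0 2 v j (∧-conicalˡ (edge 0 2 v j) _ e)
                  | edge⇒endpoints k (suc k) v j (∧-conicalʳ (edge 0 2 v j) _ e)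
      ... | inj₁ (refl , _) | inj₁ (() , _)
      ... | inj₁ (refl , _) | inj₂ (() , _)
      ... | inj₂ (refl , _) | inj₁ (() , _)
      ... | inj₂ (refl , _) | inj₂ (() , _)

    cycle-count : ∀ v → count K (Z.cycle v) ≡ double (v <ᵇ k)
    cycle-count v with v <? k
    ... | yes v<k = trans (Z.cycle-degree K v k≤K z≤n (≤-pred v<k)) (cong double (sym (<⇒<ᵇ-true v<k)))
    ... | no v≮k = trans (Z.cycle-degree-off K v (λ (_ , v≤) → v≮k (s≤s v≤)))
                         (cong double (sym (≥⇒<ᵇ-false (≮⇒≥ v≮k))))

    core-degree : ∀ v → v < K → count K (chordedCycle v) ≡ coreDegree v
    core-degree v _ = begin
        count K (chordedCycle v)
      ≡⟨ count-∨ K (Z.cycle v) (extra v) (λ j _ → cycle-disjoint-extra v j) ⟩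
        count K (Z.cycle v) + count K (extra v)
      ≡⟨ cong₂ _+_ (cycle-count v)
           (trans (count-∨ K (edge 0 2 v) (edge k (suc k) v) (λ j _ → chord-disjoint-pair v j))
             (cong₂ _+_ (edge-degree K 0 2 v (s≤s z≤n) (≤-trans (s≤s (s≤s (s≤s z≤n))) k≤K) λ ())
                        (edge-degree K k (suc k) v k<K ≤-refl k≢1+k))) ⟩
        coreDegree v
      ∎
      where open ≡-Reasoning

    core : Realization K coreDegree
    core = record
      { adjacency = chordedCycle
      ; symmetric = ∪-sym Z.cycle extra Z.cycle-sym
          (∪-sym (edge 0 2) (edge k (suc k)) (edge-sym 0 2) (edge-sym k (suc k)))
      ; irreflexive = ∪-irreflexive Z.cycle extra Z.cycle-irreflexive
          (∪-irreflexive (edge 0 2) (edge k (suc k)) (edge-irreflexive 0 2 λ ()) (edge-irreflexive k (suc k) k≢1+k))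
      ; degree≡ = core-degree }

    coreDegree-cycle : ∀ v → 3 ≤ v → v < k → coreDegree v ≡ 2
    coreDegree-cycle v 3≤v v<k
      rewrite <⇒<ᵇ-true v<k
            | ≢⇒≡ᵇ-false {v} {0} (λ e → 1+n≰n (≤-trans (≤-trans (s≤s z≤n) 3≤v) (≤-reflexive e)))
            | ≢⇒≡ᵇ-false {v} {2} (λ e → 1+n≰n (≤-trans 3≤v (≤-reflexive e)))
            | ≢⇒≡ᵇ-false {v} {k} (λ e → <-irrefl e v<k)
            | ≢⇒≡ᵇ-false {v} {suc k} (λ e → <-irrefl e (≤-trans v<k (n≤1+n k))) = refl

    coreDegree-k : coreDegree k ≡ 1
    coreDegree-k rewrite ≥⇒<ᵇ-false {k} {k} ≤-refl | ≡ᵇ-refl k | ≢⇒≡ᵇ-false k≢1+k = refl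

    coreDegree-1+k : coreDegree (suc k) ≡ 1
    coreDegree-1+k
      rewrite ≥⇒<ᵇ-false {suc k} {k} (n≤1+n k) | ≡ᵇ-refl k | ≢⇒≡ᵇ-false {suc k} {k} (λ e → k≢1+k (sym e)) = refl

    d-k : d k ≡ 1
    d-k = leaf k ≤-refl (≤-trans (n≤1+n (suc k)) 6+k′≤n)

    d-1+k : d (suc k) ≡ 1
    d-1+k = leaf (suc k) (n≤1+n k) 6+k′≤n

    coreDegree≤ : ∀ v → v < K → coreDegree v ≤ d (swap12 v)
    coreDegree≤ 0 _ = 3≤d0
    coreDegree≤ 1 _ = large 2 (s≤s (s≤s (s≤s z≤n)))
    coreDegree≤ 2 _ = 3≤d1
    coreDegree≤ v@(suc (suc (suc _))) v<K with v <? k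
    ... | yes v<k rewrite coreDegree-cycle v (s≤s (s≤s (s≤s z≤n))) v<k = large v v<k
    ... | no v≮k with m≤n⇒m<n∨m≡n (≤-pred v<K)
    ...   | inj₂ refl = ≤-reflexive (trans coreDegree-1+k (sym d-1+k))
    ...   | inj₁ v<1+k with ≤-antisym (≤-pred v<1+k) (≮⇒≥ v≮k)
    ...     | refl = ≤-reflexive (trans coreDegree-k (sym d-k))

    pendants : ℕ → ℕ
    pendants v = d (swap12 v) ∸ coreDegree v


    coreDegree+pendants : ∀ v → v < K → d (swap12 v) ≡ coreDegree v + pendants v
    coreDegree+pendants v v<K = sym (m+[n∸m]≡n (coreDegree≤ v v<K))

    sum-coreDegree : sumBelow K coreDegree ≡ (k + k) + (2 + 2)
    sum-coreDegree = begin
        sumBelow K coreDegree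
      ≡⟨ sumBelow-+ K (λ v → double (v <ᵇ k)) (λ v → ind-pair 0 2 v + ind-pair k (suc k) v) ⟩
        sumBelow K (λ v → double (v <ᵇ k)) + sumBelow K (λ v → ind-pair 0 2 v + ind-pair k (suc k) v)
      ≡⟨ cong₂ _+_ (trans (sumBelow-+ K (λ v → indicator (v <ᵇ k)) (λ v → indicator (v <ᵇ k)))
                          (cong₂ _+_ below-k below-k))
                   (trans (sumBelow-+ K (ind-pair 0 2) (ind-pair k (suc k)))
                          (cong₂ _+_ (count-pair 0 2 (s≤s z≤n) (≤-trans (s≤s (s≤s (s≤s z≤n))) k≤K))
                                     (count-pair k (suc k) k<K ≤-refl))) ⟩
        (k + k) + (2 + 2)
      ∎
      where
      open ≡-Reasoning
      ind-pair : ℕ → ℕ → ℕ → ℕ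
      ind-pair a b v = indicator (v ≡ᵇ a) + indicator (v ≡ᵇ b)
      count-pair : ∀ a b → a < K → b < K → sumBelow K (ind-pair a b) ≡ 2
      count-pair a b a<K b<K = trans (sumBelow-+ K (λ v → indicator (v ≡ᵇ a)) (λ v → indicator (v ≡ᵇ b)))
                                     (cong₂ _+_ (count-≡ᵇ K a a<K) (count-≡ᵇ K b b<K))
      below-k : count K (_<ᵇ k) ≡ k
      below-k = count-<ᵇ K k k≤K

    sum-swapped : sumBelow K (λ v → d (swap12 v)) ≡ (n + k) + 2
    sum-swapped = begin
        sumBelow K (λ v → d (swap12 v))
      ≡⟨ sumBelow-snoc (suc k) (λ v → d (swap12 v)) ⟩
        sumBelow (suc k) (λ v → d (swap12 v)) + d (suc k)
      ≡⟨ cong (_+ d (suc k)) (sumBelow-snoc k (λ v → d (swap12 v))) ⟩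
        (sumBelow k (λ v → d (swap12 v)) + d k) + d (suc k)
      ≡⟨ cong₂ _+_ (cong₂ _+_ (trans (sumBelow-swap12 k d (s≤s (s≤s (s≤s z≤n)))) sum-large) d-k) d-1+k ⟩
        ((n + k) + 1) + 1
      ≡⟨ +-assoc (n + k) 1 1 ⟩
        (n + k) + 2
      ∎
      where open ≡-Reasoning

    n≡K+pendants : n ≡ K + sumBelow K pendants
    n≡K+pendants = +-cancelʳ-≡ (k + 2) n (K + P) (sym (begin
        (K + P) + (k + 2)
      ≡⟨ rearrange k P ⟩
        P + ((k + k) + (2 + 2))
      ≡⟨ cong (P +_) (sym sum-coreDegree) ⟩
        P + sumBelow K coreDegree
      ≡⟨ +-comm P _ ⟩
        sumBelow K coreDegree + P
      ≡⟨ sym (sumBelow-+ K coreDegree pendants) ⟩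
        sumBelow K (λ v → coreDegree v + pendants v)
      ≡⟨ sumBelow-cong K (λ v v<K → sym (coreDegree+pendants v v<K)) ⟩
        sumBelow K (λ v → d (swap12 v))
      ≡⟨ trans sum-swapped (+-assoc n k 2) ⟩
        n + (k + 2)
      ∎))
      where
      open ≡-Reasoning
      P = sumBelow K pendants
      rearrange : ∀ k P → 2 + k + P + (k + 2) ≡ P + ((k + k) + (2 + 2))
      rearrange = solve-∀

    side : ℕ → Bool
    side i = (i ≡ᵇ k) ∨ (i ≡ᵇ suc k)

    side-cycle : ∀ i → i < k → side i ≡ false
    side-cycle i i<k = cong₂ _∨_ (≢⇒≡ᵇ-false {i} {k} (λ e → <-irrefl e i<k))
                                (≢⇒≡ᵇ-false {i} {suc k} (λ e → <-irrefl e (≤-trans i<k (n≤1+n k))))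

    side-k : side k ≡ true
    side-k = cong (_∨ (k ≡ᵇ suc k)) (≡ᵇ-refl k)

    side-1+k : side (suc k) ≡ true
    side-1+k = trans (cong ((suc k ≡ᵇ k) ∨_) (≡ᵇ-refl (suc k))) (∨-zeroʳ _)

    side-core : ∀ i j → chordedCycle i j ≡ true → side i ≡ side j
    side-core i j e with edge-kind i j e
    ... | cycle-edge i<k j<k         = trans (side-cycle i i<k) (sym (side-cycle j j<k))
    ... | chord (inj₁ (refl , refl)) = refl
    ... | chord (inj₂ (refl , refl)) = refl
    ... | pair (inj₁ (refl , refl))  = trans side-k (sym side-1+k)
    ... | pair (inj₂ (refl , refl))  = trans side-1+k (sym side-k)

    side-leaf : ∀ i → K ≤ i → side i ≡ false
    side-leaf i K≤i = cong₂ _∨_ (≢⇒≡ᵇ-false {i} {k} (λ e → 1+n≰n (≤-trans (≤-trans (n≤1+n (suc k)) K≤i) (≤-reflexive e))))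
                                (≢⇒≡ᵇ-false {i} {suc k} (λ e → 1+n≰n (≤-trans K≤i (≤-reflexive e))))

    side-owner : ∀ i → i < K → 0 < pendants i → side i ≡ false
    side-owner i i<K 0<pendants with i <? k
    ... | yes i<k = side-cycle i i<k
    ... | no i≮k with m≤n⇒m<n∨m≡n (≤-pred i<K)
    ...   | inj₂ refl rewrite coreDegree-1+k | d-1+k = ⊥-elim (<-irrefl refl 0<pendants)
    ...   | inj₁ i<1+k with ≤-antisym (≤-pred i<1+k) (≮⇒≥ i≮k)
    ...     | refl rewrite coreDegree-k | d-k = ⊥-elim (<-irrefl refl 0<pendants)

    leaf-swapped : ∀ v → K ≤ v → v < n → d (swap12 v) ≡ 1
    leaf-swapped v@(suc (suc (suc _))) K≤v v<n = leaf v (≤-trans k≤K K≤v) v<n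
    leaf-swapped 1 (s≤s ()) _
    leaf-swapped 2 (s≤s (s≤s ())) _

    swapped : DisconnectedRealization n (λ v → d (swap12 v))
    swapped = Pendants.disconnected-withPendants core support pendants n (λ v → d (swap12 v)) n≡K+pendants
      coreDegree+pendants leaf-swapped side side-core side-leaf side-owner 0 k
      (≤-trans (s≤s z≤n) 6+k′≤n) (≤-trans (n≤1+n (suc k)) 6+k′≤n) (λ e → false≢true (trans e side-k))

  chordedCycle-disconnected : DisconnectedRealization n d
  chordedCycle-disconnected = DisconnectedRealization-swap12 (≤-trans (s≤s (s≤s (s≤s z≤n))) 6+k′≤n) swapped

-- Connectivity of realizations

reach-if-degree-sum : ∀ {n} (G : Graph n) v r → v ≢ r → n < degree G v + degree G r + 2 → Reach G v r
reach-if-degree-sum G v r v≢r n<sum with adj G v r in e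
... | true  = step e here
... | false with commonNeighbour G v r v≢r e n<sum
...   | w , vw , rw = step vw (step (trans (Graph.sym G w r) rw) here)

reach-if-hub : ∀ {n} (G : Graph n) v r → 1 ≤ degree G v → n < degree G r + 3 → Reach G v r
reach-if-hub G v r 1≤deg n<hub with v ≟F r
... | yes refl = here
... | no v≢r with adj G v r in e₁
...   | true  = step e₁ here
...   | false with 1≤degree⇒neighbour G v 1≤deg
...     | w , vw with adj G w r in e₂
...       | true  = step vw (step e₂ here)
...       | false = ⊥-elim (<⇒≱ n<hub (degree+3≤n G r v w (λ e → v≢r (sym e)) (λ e → w≢r (sym e)) v≢w
                                         (trans (Graph.sym G r v) e₁) (trans (Graph.sym G r w) e₂)))
  where
  w≢r : w ≢ r
  w≢r refl = false≢true (trans (sym e₁) vw)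
  v≢w : v ≢ w
  v≢w refl = false≢true (trans (sym (irrefl G v)) vw)

hub-connected : ∀ n m → n ≡ 4 + m → (G : Graph n) → (∀ i → degree G i ≡ hubDegrees m 4 (toℕ i)) →
  Connected G
hub-connected _ m refl G deg = rootedReach⇒Connected G fz λ v →
  reach-if-hub G v fz (subst (1 ≤_) (sym (deg v)) (positive (toℕ v)))
                      (subst (λ x → 4 + m < x + 3) (sym (deg fz)) (≤-reflexive (cong (2 +_) (+-comm 3 m))))
  where
  positive : ∀ v → 1 ≤ hubDegrees m 4 v
  positive 0 = s≤s z≤n
  positive (suc v) with suc v <ᵇ 4
  ... | true  = s≤s z≤n
  ... | false = s≤s z≤n

cycle5-connected : (G : Graph 5) → (∀ i → degree G i ≡ 2) → Connected G
cycle5-connected G deg = rootedReach⇒Connected G fz reach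
  where
  reach : ∀ v → Reach G v fz
  reach v with v ≟F fz
  ... | yes refl = here
  ... | no v≢0   = reach-if-degree-sum G v fz v≢0 (subst (5 <_) (sym (cong₂ (λ a b → a + b + 2) (deg v) (deg fz)))
                                                          (s≤s ≤-refl))

case1b-connected : (G : Graph 6) → (∀ i → degree G i ≡ hubDegrees 1 5 (toℕ i)) → Connected G
case1b-connected G deg = rootedReach⇒Connected G fz reach
  where
  leaf : Fin 6
  leaf = fs (fs (fs (fs (fs fz))))
  2≤degree : ∀ v → v ≢ leaf → 2 ≤ degree G v
  2≤degree v v≢leaf = subst (2 ≤_) (sym (deg v)) (2≤hub v v≢leaf)
    where
    2≤hub : ∀ v → v ≢ leaf → 2 ≤ hubDegrees 1 5 (toℕ v)
    2≤hub fz _ = s≤s (s≤s z≤n)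
    2≤hub (fs fz) _ = s≤s (s≤s z≤n)
    2≤hub (fs (fs fz)) _ = s≤s (s≤s z≤n)
    2≤hub (fs (fs (fs fz))) _ = s≤s (s≤s z≤n)
    2≤hub (fs (fs (fs (fs fz)))) _ = s≤s (s≤s z≤n)
    2≤hub (fs (fs (fs (fs (fs fz))))) v≢leaf = ⊥-elim (v≢leaf refl)
  reach-non-leaf : ∀ v → v ≢ leaf → Reach G v fz
  reach-non-leaf v v≢leaf with v ≟F fz
  ... | yes refl = here
  ... | no v≢0 = reach-if-degree-sum G v fz v≢0
                   (+-monoˡ-≤ 2 {5} (+-mono-≤ (2≤degree v v≢leaf) (≤-reflexive (sym (deg fz)))))
  reach : ∀ v → Reach G v fz
  reach v with v ≟F leaf
  ... | no v≢leaf = reach-non-leaf v v≢leaf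
  ... | yes refl with 1≤degree⇒neighbour G leaf (subst (1 ≤_) (sym (deg leaf)) (s≤s z≤n))
  ...   | w , leaf-w = step leaf-w (reach-non-leaf w λ { refl → false≢true (trans (sym (irrefl G leaf)) leaf-w) })

tight-sum : ∀ {a b x y} → a ≤ x → b ≤ y → a + b ≡ x + y → (a ≡ x) × (b ≡ y)
tight-sum {a} {b} {x} {y} a≤x b≤y sum≡ = ≤-antisym a≤x x≤a , ≤-antisym b≤y y≤b
  where
  x≤a : x ≤ a
  x≤a = +-cancelʳ-≤ y x a (≤-trans (≤-reflexive (sym sum≡)) (+-monoʳ-≤ a b≤y))
  y≤b : y ≤ b
  y≤b = +-cancelˡ-≤ x y b (≤-trans (≤-reflexive (sym sum≡)) (+-monoˡ-≤ b a≤x))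

indicator-both : ∀ a b → indicator a + indicator b ≡ 2 → (a ≡ true) × (b ≡ true)
indicator-both true  true  _ = refl , refl
indicator-both true  false ()
indicator-both false true  ()
indicator-both false false ()

indicator-some : ∀ a b c → indicator a + (indicator b + indicator c) ≡ 1 →
  (a ≡ true) ⊎ (b ≡ true) ⊎ (c ≡ true)
indicator-some true  b     c    _ = inj₁ refl
indicator-some false true  c    _ = inj₂ (inj₁ refl)
indicator-some false false true _ = inj₂ (inj₂ refl)

module ThreeHeads (m : ℕ) (G : Graph (3 + m)) where
  private
    A = adj G
    ind = indicator

  v₀ v₁ v₂ : Fin (3 + m)
  v₀ = fz
  v₁ = fs fz
  v₂ = fs (fs fz)

  leaf : Fin m → Fin (3 + m)
  leaf w = fs (fs (fs w))

  towardsHeads : Fin (3 + m) → ℕ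
  towardsHeads i = ind (A i v₀) + (ind (A i v₁) + ind (A i v₂))

  towardsLeaves : Fin (3 + m) → ℕ
  towardsLeaves i = ∑[ w < m ] ind (A i (leaf w))

  towardsHeads≤degree : ∀ i → towardsHeads i ≤ degree G i
  towardsHeads≤degree i = subst (towardsHeads i ≤_) (sym (degree≡sumᶠ G i))
    (+-monoʳ-≤ (ind (A i v₀)) (+-monoʳ-≤ (ind (A i v₁)) (m≤m+n (ind (A i v₂)) (towardsLeaves i))))

  towardsHeads≤2 : ∀ i → i ≡ v₀ ⊎ i ≡ v₁ ⊎ i ≡ v₂ → towardsHeads i ≤ 2
  towardsHeads≤2 i (inj₁ refl) rewrite irrefl G v₀ = +-mono-≤ (indicator≤1 (A v₀ v₁)) (indicator≤1 (A v₀ v₂))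
  towardsHeads≤2 i (inj₂ (inj₁ refl)) rewrite irrefl G v₁ = +-mono-≤ (indicator≤1 (A v₁ v₀)) (indicator≤1 (A v₁ v₂))
  towardsHeads≤2 i (inj₂ (inj₂ refl)) rewrite irrefl G v₂ =
    +-mono-≤ (indicator≤1 (A v₂ v₀)) (≤-trans (≤-reflexive (+-identityʳ _)) (indicator≤1 (A v₂ v₁)))

  heads-degree-sum : degree G v₀ + (degree G v₁ + degree G v₂) ≡
    (towardsHeads v₀ + (towardsHeads v₁ + towardsHeads v₂)) + ∑[ w < m ] towardsHeads (leaf w)
  heads-degree-sum = begin
      degree G v₀ + (degree G v₁ + degree G v₂)
    ≡⟨ cong₂ _+_ (split v₀) (cong₂ _+_ (split v₁) (split v₂)) ⟩
      (towardsHeads v₀ + towardsLeaves v₀)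
        + ((towardsHeads v₁ + towardsLeaves v₁) + (towardsHeads v₂ + towardsLeaves v₂))
    ≡⟨ rearrange (towardsHeads v₀) (towardsHeads v₁) (towardsHeads v₂) _ _ _ ⟩
      (towardsHeads v₀ + (towardsHeads v₁ + towardsHeads v₂))
        + (towardsLeaves v₀ + (towardsLeaves v₁ + towardsLeaves v₂))
    ≡⟨ cong (towardsHeads v₀ + (towardsHeads v₁ + towardsHeads v₂) +_)
            (sym (trans (sum-cong-≗ {m} λ w → cong₂ _+_ (flip w v₀) (cong₂ _+_ (flip w v₁) (flip w v₂)))
                        (trans (∑-distrib-+ {m} (λ w → to w v₀) (λ w → to w v₁ + to w v₂))
                               (cong (towardsLeaves v₀ +_) (∑-distrib-+ {m} (λ w → to w v₁) (λ w → to w v₂)))))) ⟩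
      (towardsHeads v₀ + (towardsHeads v₁ + towardsHeads v₂)) + ∑[ w < m ] towardsHeads (leaf w)
    ∎
    where
    open ≡-Reasoning
    split : ∀ i → degree G i ≡ towardsHeads i + towardsLeaves i
    split i = trans (degree≡sumᶠ G i)
      (trans (cong (ind (A i v₀) +_) (sym (+-assoc (ind (A i v₁)) _ _))) (sym (+-assoc (ind (A i v₀)) _ _)))
    to : Fin m → Fin (3 + m) → ℕ
    to w i = ind (A i (leaf w))
    flip : ∀ w i → ind (A (leaf w) i) ≡ to w i
    flip w i = cong ind (Graph.sym G (leaf w) i)
    rearrange : ∀ a b c x y z → (a + x) + ((b + y) + (c + z)) ≡ (a + (b + c)) + (x + (y + z))
    rearrange = solve-∀

-- The leaves account for only m of the degree sum 6 + m of the heads, so the heads form a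
-- triangle and each leaf is adjacent to a head.
case3-connected : ∀ n m → n ≡ 3 + m → (G : Graph n) → ∀ r s t → r + (s + t) ≡ 6 + m →
  (∀ i → degree G i ≡ case3Degrees r s t (toℕ i)) → Connected G
case3-connected _ m refl G r s t r+s+t≡ deg = rootedReach⇒Connected G v₀ reach
  where
  open ThreeHeads m G
  H = towardsHeads v₀ + (towardsHeads v₁ + towardsHeads v₂)
  H≤6 : H ≤ 6
  H≤6 = +-mono-≤ (towardsHeads≤2 v₀ (inj₁ refl)) (+-mono-≤ (towardsHeads≤2 v₁ (inj₂ (inj₁ refl)))
                                                          (towardsHeads≤2 v₂ (inj₂ (inj₂ refl))))
  leaves≤m : ∑[ w < m ] towardsHeads (leaf w) ≤ m
  leaves≤m = ≤-trans (sumᶠ-≤ m (λ w → towardsHeads≤degree (leaf w)))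
                     (≤-reflexive (trans (sum-cong-≗ {m} (λ w → deg (leaf w))) (sumᶠ-const1 m)))
  tight : (H ≡ 6) × (∑[ w < m ] towardsHeads (leaf w) ≡ m)
  tight = tight-sum H≤6 leaves≤m (trans (sym heads-degree-sum)
            (trans (cong₂ _+_ (deg v₀) (cong₂ _+_ (deg v₁) (deg v₂))) r+s+t≡))
  v₀-heads : (adj G v₀ v₁ ≡ true) × (adj G v₀ v₂ ≡ true)
  v₀-heads = indicator-both _ _ (trans (cong (λ b → indicator b + (indicator (adj G v₀ v₁) + indicator (adj G v₀ v₂)))
                                             (sym (irrefl G v₀)))
               (proj₁ (tight-sum (towardsHeads≤2 v₀ (inj₁ refl))
                 (+-mono-≤ (towardsHeads≤2 v₁ (inj₂ (inj₁ refl))) (towardsHeads≤2 v₂ (inj₂ (inj₂ refl))))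
                 (proj₁ tight))))
  leaf-head : ∀ w → towardsHeads (leaf w) ≡ 1
  leaf-head = sumᶠ≡n⇒all≡1 m (λ w → towardsHeads (leaf w))
                (λ w → ≤-trans (towardsHeads≤degree (leaf w)) (≤-reflexive (deg (leaf w)))) (proj₂ tight)
  reach₁ : Reach G v₁ v₀
  reach₁ = step (trans (Graph.sym G v₁ v₀) (proj₁ v₀-heads)) here
  reach₂ : Reach G v₂ v₀
  reach₂ = step (trans (Graph.sym G v₂ v₀) (proj₂ v₀-heads)) here
  reach : ∀ v → Reach G v v₀
  reach fz = here
  reach (fs fz) = reach₁
  reach (fs (fs fz)) = reach₂
  reach (fs (fs (fs w))) with indicator-some _ _ _ (leaf-head w)
  ... | inj₁ e        = step e here
  ... | inj₂ (inj₁ e) = step e reach₁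
  ... | inj₂ (inj₂ e) = step e reach₂

two-heads-degree-bound : ∀ m (G : Graph (2 + m)) →
  degree G fz + degree G (fs fz) ≤ 2 + ∑[ w < m ] degree G (fs (fs w))
two-heads-degree-bound m G = begin
    degree G v₀ + degree G v₁
  ≡⟨ cong₂ _+_ (split v₀) (split v₁) ⟩
    (ind (A v₀ v₀) + ind (A v₀ v₁) + towardsLeaves v₀) + (ind (A v₁ v₀) + ind (A v₁ v₁) + towardsLeaves v₁)
  ≡⟨ cong₂ (λ a b → (ind a + ind (A v₀ v₁) + towardsLeaves v₀) + (ind (A v₁ v₀) + ind b + towardsLeaves v₁))
           (irrefl G v₀) (irrefl G v₁) ⟩
    (ind (A v₀ v₁) + towardsLeaves v₀) + (ind (A v₁ v₀) + 0 + towardsLeaves v₁)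
  ≡⟨ rearrange (ind (A v₀ v₁)) (ind (A v₁ v₀)) (towardsLeaves v₀) (towardsLeaves v₁) ⟩
    (ind (A v₀ v₁) + ind (A v₁ v₀)) + (towardsLeaves v₀ + towardsLeaves v₁)
  ≤⟨ +-mono-≤ (+-mono-≤ (indicator≤1 (A v₀ v₁)) (indicator≤1 (A v₁ v₀))) (≤-reflexive leaves-sum) ⟩
    2 + ∑[ w < m ] towardsHeads w
  ≤⟨ +-monoʳ-≤ 2 (sumᶠ-≤ m towardsHeads≤degree) ⟩
    2 + ∑[ w < m ] degree G (fs (fs w))
  ∎
  where
  open ≤-Reasoning
  A = adj G
  ind = indicator
  v₀ v₁ : Fin (2 + m)
  v₀ = fz
  v₁ = fs fz
  towardsLeaves : Fin (2 + m) → ℕ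
  towardsLeaves i = ∑[ w < m ] ind (A i (fs (fs w)))
  towardsHeads : Fin m → ℕ
  towardsHeads w = ind (A (fs (fs w)) v₀) + ind (A (fs (fs w)) v₁)
  split : ∀ i → degree G i ≡ (ind (A i v₀) + ind (A i v₁)) + towardsLeaves i
  split i = trans (degree≡sumᶠ G i) (sym (+-assoc (ind (A i v₀)) _ _))
  towardsHeads≤degree : ∀ w → towardsHeads w ≤ degree G (fs (fs w))
  towardsHeads≤degree w = subst (towardsHeads w ≤_) (sym (split (fs (fs w)))) (m≤m+n (towardsHeads w) _)
  leaves-sum : towardsLeaves v₀ + towardsLeaves v₁ ≡ ∑[ w < m ] towardsHeads w
  leaves-sum = trans (sym (∑-distrib-+ {m} (λ w → ind (A v₀ (fs (fs w)))) (λ w → ind (A v₁ (fs (fs w))))))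
    (sum-cong-≗ {m} λ w → cong₂ _+_ (cong ind (Graph.sym G v₀ (fs (fs w)))) (cong ind (Graph.sym G v₁ (fs (fs w)))))
  rearrange : ∀ a b x y → (a + x) + (b + 0 + y) ≡ (a + b) + (x + y)
  rearrange = solve-∀

lookupℕ : List ℕ → ℕ → ℕ
lookupℕ []       _       = 0
lookupℕ (x ∷ xs) zero    = x
lookupℕ (x ∷ xs) (suc j) = lookupℕ xs j

lookup≡lookupℕ : ∀ (D : List ℕ) (i : Fin (length D)) → lookup D i ≡ lookupℕ D (toℕ i)
lookup≡lookupℕ (x ∷ xs) fz     = refl
lookup≡lookupℕ (x ∷ xs) (fs i) = lookup≡lookupℕ xs i

lookupℕ-ext : ∀ (D E : List ℕ) → length D ≡ length E →
  (∀ j → j < length D → lookupℕ D j ≡ lookupℕ E j) → D ≡ E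
lookupℕ-ext []      []      _       _   = refl
lookupℕ-ext (x ∷ D) (y ∷ E) len≡ D≡E =
  cong₂ _∷_ (D≡E 0 (s≤s z≤n)) (lookupℕ-ext D E (suc-injective len≡) (λ j j<n → D≡E (suc j) (s≤s j<n)))

lookupℕ-replicate : ∀ m c j → j < m → lookupℕ (replicate m c) j ≡ c
lookupℕ-replicate (suc m) c zero    _         = refl
lookupℕ-replicate (suc m) c (suc j) (s≤s j<m) = lookupℕ-replicate m c j j<m

realizes⇒degree≡ : ∀ D (G : Graph (length D)) → Realizes D G → ∀ i → degree G i ≡ lookupℕ D (toℕ i)
realizes⇒degree≡ D G realizes i = trans (realizes i) (lookup≡lookupℕ D i)

degree≡⇒realizes : ∀ D (G : Graph (length D)) → (∀ i → degree G i ≡ lookupℕ D (toℕ i)) → Realizes D G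
degree≡⇒realizes D G deg i = trans (deg i) (sym (lookup≡lookupℕ D i))

m+m≡n+n⇒m≡n : ∀ {m n} → m + m ≡ n + n → m ≡ n
m+m≡n+n⇒m≡n {m} {n} e with <-cmp m n
... | tri< m<n _ _ = ⊥-elim (<-irrefl e (+-mono-< m<n m<n))
... | tri≈ _ m≡n _ = m≡n
... | tri> _ _ n<m = ⊥-elim (<-irrefl (sym e) (+-mono-< n<m n<m))

sum-degree≡sumBelow : ∀ n (G : Graph n) (d : ℕ → ℕ) → (∀ i → degree G i ≡ d (toℕ i)) →
  ∑[ i < n ] degree G i ≡ sumBelow n d
sum-degree≡sumBelow n G d deg = sum-cong-≗ {n} deg

edgeCount≡n : ∀ n (G : Graph n) (d : ℕ → ℕ) → (∀ i → degree G i ≡ d (toℕ i)) → sumBelow n d ≡ n + n →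
  edgeCount G ≡ n
edgeCount≡n n G d deg sum≡ = m+m≡n+n⇒m≡n (trans (sym (handshake G)) (trans (sum-degree≡sumBelow n G d deg) sum≡))

forciblyUnicyclic : ∀ D n → length D ≡ n → (d : ℕ → ℕ) → (∀ j → j < n → lookupℕ D j ≡ d j) →
  Realization n d → (∀ (G : Graph n) → (∀ i → degree G i ≡ d (toℕ i)) → Connected G) →
  sumBelow n d ≡ n + n → ForciblyUnicyclicGraphic D
forciblyUnicyclic D _ refl d D≡d R connected sum≡ =
  (graphOf R , degree≡⇒realizes D (graphOf R) λ i → trans (graphOf-degree R i) (sym (D≡d (toℕ i) (toℕ<n i)))) ,
  λ G realizes → let deg = λ i → trans (realizes⇒degree≡ D G realizes i) (D≡d (toℕ i) (toℕ<n i))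
                 in connected G deg , edgeCount≡n (length D) G d deg sum≡

-- The sequences of cases (1)–(3) are forcibly unicyclic

case1-forcibly : ∀ D → Case1 D → ForciblyUnicyclicGraphic D
case1-forcibly _ (inj₁ refl) =
  forciblyUnicyclic (replicate 5 2) 5 refl (λ _ → 2) (lookupℕ-replicate 5 2)
    (Realization-cast refl all-two (hub-realization 0 2)) cycle5-connected refl
  where
  all-two : ∀ v → v < 5 → hubDegrees 0 5 v ≡ 2
  all-two 0 _ = refl
  all-two 1 _ = refl
  all-two 2 _ = refl
  all-two 3 _ = refl
  all-two 4 _ = refl
  all-two (suc (suc (suc (suc (suc v))))) (s≤s (s≤s (s≤s (s≤s (s≤s ())))))
case1-forcibly _ (inj₂ refl) =
  forciblyUnicyclic (3 ∷ replicate 4 2 ++ 1 ∷ []) 6 refl (hubDegrees 1 5) terms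
    (hub-realization 1 2) case1b-connected refl
  where
  terms : ∀ j → j < 6 → lookupℕ (3 ∷ replicate 4 2 ++ 1 ∷ []) j ≡ hubDegrees 1 5 j
  terms 0 _ = refl
  terms 1 _ = refl
  terms 2 _ = refl
  terms 3 _ = refl
  terms 4 _ = refl
  terms 5 _ = refl
  terms (suc (suc (suc (suc (suc (suc j)))))) (s≤s (s≤s (s≤s (s≤s (s≤s (s≤s ()))))))

case2-forcibly : ∀ D → Case2 D → ForciblyUnicyclicGraphic D
case2-forcibly D (4≤n , D≡) =
  forciblyUnicyclic D n refl (hubDegrees m 4) terms (Realization-cast (sym n≡) (λ _ _ → refl) (hub-realization m 1))
    (hub-connected n m n≡) (subst (λ k → sumBelow k (hubDegrees m 4) ≡ k + k) (sym n≡) hub-sum)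
  where
  n = length D
  m = n ∸ 4
  n≡ : n ≡ 4 + m
  n≡ = sym (m+[n∸m]≡n 4≤n)
  terms : ∀ j → j < n → lookupℕ D j ≡ hubDegrees m 4 j
  terms j j<n = trans (cong (λ E → lookupℕ E j) D≡) (listed j j<n)
    where
    listed : ∀ j → j < n → lookupℕ ((n ∸ 2) ∷ replicate 3 2 ++ replicate m 1) j ≡ hubDegrees m 4 j
    listed 0 _ = cong (_∸ 2) n≡
    listed 1 _ = refl
    listed 2 _ = refl
    listed 3 _ = refl
    listed (suc (suc (suc (suc j)))) j<n = lookupℕ-replicate m 1 j (+-cancelˡ-< 4 j m (subst (4 + j <_) n≡ j<n))
  hub-sum : sumBelow (4 + m) (hubDegrees m 4) ≡ (4 + m) + (4 + m)
  hub-sum = trans (cong (λ x → (2 + m) + (2 + (2 + (2 + x)))) (sumBelow-const m 1)) (rearrange m)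
    where
    rearrange : ∀ m → (2 + m) + (2 + (2 + (2 + m * 1))) ≡ (4 + m) + (4 + m)
    rearrange = solve-∀

case3-forcibly : ∀ D → Case3 D → ForciblyUnicyclicGraphic D
case3-forcibly D (3≤n , r , s , t , s≤r , t≤s , 2≤t , r+s+t≡ , D≡) =
  forciblyUnicyclic D n refl (case3Degrees r s t) terms triangle
    (λ G → case3-connected n m n≡ G r s t r+[s+t]≡) sum≡
  where
  n = length D
  m = n ∸ 3
  n≡ : n ≡ 3 + m
  n≡ = sym (m+[n∸m]≡n 3≤n)
  terms : ∀ j → j < n → lookupℕ D j ≡ case3Degrees r s t j
  terms j j<n = trans (cong (λ E → lookupℕ E j) D≡) (listed j j<n)
    where
    listed : ∀ j → j < n → lookupℕ (r ∷ s ∷ t ∷ replicate m 1) j ≡ case3Degrees r s t j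
    listed 0 _ = refl
    listed 1 _ = refl
    listed 2 _ = refl
    listed (suc (suc (suc j))) j<n = lookupℕ-replicate m 1 j (+-cancelˡ-< 3 j m (subst (3 + j <_) n≡ j<n))
  2≤s = ≤-trans 2≤t t≤s
  2≤r = ≤-trans 2≤s s≤r
  r+[s+t]≡ : r + (s + t) ≡ 6 + m
  r+[s+t]≡ = trans (sym (+-assoc r s t)) (trans r+s+t≡ (trans (cong (_+ 3) n≡) (+-comm (3 + m) 3)))
  triangle : Realization n (case3Degrees r s t)
  triangle = Realization-cast size pendants (triangle-realization (r ∸ 2) (s ∸ 2) (t ∸ 2))
    where
    [r] = m+[n∸m]≡n 2≤r
    [s] = m+[n∸m]≡n 2≤s
    [t] = m+[n∸m]≡n 2≤t
    size : 3 + ((r ∸ 2) + ((s ∸ 2) + ((t ∸ 2) + 0))) ≡ n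
    size = +-cancelʳ-≡ 3 _ _ (trans (rearrange (r ∸ 2) (s ∸ 2) (t ∸ 2))
             (trans (cong₂ _+_ (cong₂ _+_ [r] [s]) [t]) r+s+t≡))
      where
      rearrange : ∀ a b c → 3 + (a + (b + (c + 0))) + 3 ≡ (2 + a) + (2 + b) + (2 + c)
      rearrange = solve-∀
    pendants : ∀ v → v < n → case3Degrees (2 + (r ∸ 2)) (2 + (s ∸ 2)) (2 + (t ∸ 2)) v ≡ case3Degrees r s t v
    pendants 0 _ = [r]
    pendants 1 _ = [s]
    pendants 2 _ = [t]
    pendants (suc (suc (suc v))) _ = refl
  sum≡ : sumBelow n (case3Degrees r s t) ≡ n + n
  sum≡ = subst (λ k → sumBelow k (case3Degrees r s t) ≡ k + k) (sym n≡)
    (trans (cong (λ x → r + (s + (t + x))) (sumBelow-const m 1)) (trans (rearrange r s t m)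
      (trans (cong (_+ m) r+[s+t]≡) (rearrange′ m))))
    where
    rearrange : ∀ r s t m → r + (s + (t + m * 1)) ≡ r + (s + t) + m
    rearrange = solve-∀
    rearrange′ : ∀ m → 6 + m + m ≡ (3 + m) + (3 + m)
    rearrange′ = solve-∀

-- Forcibly unicyclic sequences fall into cases (1)–(3)

unicyclic⇒1≤degree : ∀ {n} (G : Graph n) → Unicyclic G → ∀ i → 1 ≤ degree G i
unicyclic⇒1≤degree {1} G (_ , edges≡1) fz = ⊥-elim (0≢1+n (trans (sym no-edges) edges≡1))
  where
  no-edges : edgeCount G ≡ 0
  no-edges = trans (edgeCount≡sumᶠ G) (cong (λ b → indicator (b ∧ false) + 0 + 0) (irrefl G fz))
unicyclic⇒1≤degree {suc (suc n)} G ((_ , connected) , _) i = first-step (other≢ i) (connected i (other i))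
  where
  other : Fin (suc (suc n)) → Fin (suc (suc n))
  other fz     = fs fz
  other (fs _) = fz
  other≢ : ∀ i → i ≢ other i
  other≢ fz     ()
  other≢ (fs i) ()
  first-step : ∀ {j} → i ≢ j → Reach G i j → 1 ≤ degree G i
  first-step i≢j here       = ⊥-elim (i≢j refl)
  first-step _   (step e _) = adjacent⇒1≤degree G i _ e

-- Two terms cannot absorb n + 2 when all others are 1: vertices 0 and 1 share at most one edge.
two-large-terms-impossible : ∀ n (G : Graph n) (d : ℕ → ℕ) → (∀ i → degree G i ≡ d (toℕ i)) → 2 ≤ n →
  (∀ j → 2 ≤ j → j < n → d j ≡ 1) → d 0 + d 1 ≢ n + 2
two-large-terms-impossible 1 G d deg (s≤s ()) leaves sum≡
two-large-terms-impossible (suc (suc m)) G d deg _ leaves sum≡ =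
  <⇒≱ (m<m+n (2 + m) (s≤s z≤n)) (begin
    (2 + m) + 2                         ≡⟨ sym sum≡ ⟩
    d 0 + d 1                           ≡⟨ sym (cong₂ _+_ (deg fz) (deg (fs fz))) ⟩
    degree G fz + degree G (fs fz)      ≤⟨ two-heads-degree-bound m G ⟩
    2 + ∑[ w < m ] degree G (fs (fs w)) ≡⟨ cong (2 +_) leaves-sum ⟩
    2 + m                               ∎)
  where
  open ≤-Reasoning
  leaves-sum : ∑[ w < m ] degree G (fs (fs w)) ≡ m
  leaves-sum = trans (sum-cong-≗ {m} (λ w → deg (fs (fs w))))
    (trans (sumBelow-cong m (λ j j<m → leaves (2 + j) (s≤s (s≤s z≤n)) (s≤s (s≤s j<m))))
           (trans (sumBelow-const m 1) (*-identityʳ m)))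

hubList : ℕ → ℕ → List ℕ
hubList L K = (2 + L) ∷ replicate (pred K) 2 ++ replicate L 1

lookupℕ-replicate-++ : ∀ a x (R : List ℕ) i → lookupℕ (replicate a x ++ R) (a + i) ≡ lookupℕ R i
lookupℕ-replicate-++ zero    x R i = refl
lookupℕ-replicate-++ (suc a) x R i = lookupℕ-replicate-++ a x R i

lookupℕ-replicate-++ˡ : ∀ a x (R : List ℕ) j → j < a → lookupℕ (replicate a x ++ R) j ≡ x
lookupℕ-replicate-++ˡ (suc a) x R zero    _         = refl
lookupℕ-replicate-++ˡ (suc a) x R (suc j) (s≤s j<a) = lookupℕ-replicate-++ˡ a x R j j<a

lookupℕ-hubList : ∀ L K j → j < suc K + L → lookupℕ (hubList L (suc K)) j ≡ hubDegrees L (suc K) j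
lookupℕ-hubList L K zero    _ = refl
lookupℕ-hubList L K (suc j) 1+j<n with j <? K
... | yes j<K = trans (lookupℕ-replicate-++ˡ K 2 _ j j<K) (sym (hubDegrees-body L (suc K) (suc j) (s≤s z≤n) (s≤s j<K)))
... | no j≮K  = trans (cong (lookupℕ (replicate K 2 ++ replicate L 1)) (sym (m+[n∸m]≡n K≤j)))
                (trans (lookupℕ-replicate-++ K 2 (replicate L 1) (j ∸ K))
                  (trans (lookupℕ-replicate L 1 (j ∸ K) (+-cancelˡ-< K _ L (subst (_< K + L) (sym (m+[n∸m]≡n K≤j)) (≤-pred 1+j<n))))
                         (sym (hubDegrees-tail L (suc K) j (s≤s K≤j)))))
  where K≤j = ≮⇒≥ j≮K

length-hubList : ∀ L K → length (hubList L (suc K)) ≡ suc K + L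
length-hubList L K = cong suc (trans (length-++ (replicate K 2)) (cong₂ _+_ (length-replicate K) (length-replicate L)))

module Classification (D : List ℕ) (nonIncreasing : NonIncreasing D) (F : ForciblyUnicyclicGraphic D) where
  private
    n = length D
    d = lookupℕ D

    G₀ : Graph n
    G₀ = proj₁ (proj₁ F)

    degree-G₀ : ∀ i → degree G₀ i ≡ d (toℕ i)
    degree-G₀ = realizes⇒degree≡ D G₀ (proj₂ (proj₁ F))

    unicyclic-G₀ : Unicyclic G₀
    unicyclic-G₀ = proj₂ F G₀ (proj₂ (proj₁ F))

    1≤n : 1 ≤ n
    1≤n = proj₁ (proj₁ unicyclic-G₀)

    degree-sum : sumBelow n d ≡ n + n
    degree-sum = trans (sym (sum-degree≡sumBelow n G₀ d degree-G₀))
      (trans (handshake G₀) (cong₂ _+_ (proj₂ unicyclic-G₀) (proj₂ unicyclic-G₀)))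

    degree-at : ∀ j (j<n : j < n) → degree G₀ (fromℕ< j<n) ≡ d j
    degree-at j j<n = trans (degree-G₀ (fromℕ< j<n)) (cong d (toℕ-fromℕ< j<n))

    positive : ∀ j → j < n → 1 ≤ d j
    positive j j<n = subst (1 ≤_) (degree-at j j<n) (unicyclic⇒1≤degree G₀ unicyclic-G₀ (fromℕ< j<n))

    antitone : ∀ i j → i ≤ j → j < n → d j ≤ d i
    antitone i j i≤j j<n = subst₂ _≤_ (at j<n) (at i<n)
      (nonIncreasing (fromℕ< i<n) (fromℕ< j<n) (subst₂ _≤_ (sym (toℕ-fromℕ< i<n)) (sym (toℕ-fromℕ< j<n)) i≤j))
      where
      i<n = ≤-<-trans i≤j j<n
      at : ∀ {k} (k<n : k < n) → lookup D (fromℕ< k<n) ≡ d k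
      at k<n = trans (lookup≡lookupℕ D (fromℕ< k<n)) (cong d (toℕ-fromℕ< k<n))

    not-disconnected : ∀ {m d′} → m ≡ n → DisconnectedRealization m d′ → (∀ v → v < n → d′ v ≡ d v) → ⊥
    not-disconnected m≡n R d′≡d =
      graphOf-¬Connected R′ (proj₁ (proj₂ F G (degree≡⇒realizes D G (graphOf-degree (realization R′)))))
      where
      R′ : DisconnectedRealization n d
      R′ = DisconnectedRealization-cast m≡n d′≡d R
      G = graphOf (realization R′)

  Threshold : ℕ → Set
  Threshold k = (k ≤ n) × (∀ j → j < k → 2 ≤ d j) × (∀ j → k ≤ j → j < n → d j ≡ 1)

  private
    find-threshold : ∀ r c → c + r ≡ n → (∀ j → j < c → 2 ≤ d j) → Σ ℕ Threshold
    find-threshold zero c c≡n large = c , ≤-reflexive (trans (sym (+-identityʳ c)) c≡n) , large ,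
      λ j c≤j j<n → ⊥-elim (1+n≰n (≤-trans j<n (≤-trans (≤-reflexive (trans (sym c≡n) (+-identityʳ c))) c≤j)))
    find-threshold (suc r) c c+r≡n large with 2 ≤? d c
    ... | yes 2≤dc = find-threshold r (suc c) (trans (sym (+-suc c r)) c+r≡n) large′
      where
      large′ : ∀ j → j < suc c → 2 ≤ d j
      large′ j j<1+c with m≤n⇒m<n∨m≡n (≤-pred j<1+c)
      ... | inj₁ j<c  = large j j<c
      ... | inj₂ refl = 2≤dc
    ... | no 2≰dc = c , ≤-trans (m≤m+n c (suc r)) (≤-reflexive c+r≡n) , large ,
      λ j c≤j j<n → ≤-antisym (≤-trans (antitone c j c≤j j<n) (≤-pred (≰⇒> 2≰dc))) (positive j j<n)

    threshold : Σ ℕ Threshold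
    threshold = find-threshold n 0 refl (λ j ())

    -- The ones after the threshold account for n - k of the degree sum 2n.
    sum-large : ∀ k → Threshold k → sumBelow k d ≡ n + k
    sum-large k (k≤n , _ , one) = +-cancelʳ-≡ (n ∸ k) _ _ (begin
        sumBelow k d + (n ∸ k)
      ≡⟨ cong (sumBelow k d +_) (sym ones) ⟩
        sumBelow k d + sumBelow (n ∸ k) (λ j → d (k + j))
      ≡⟨ sym (sumBelow-split k (n ∸ k) d) ⟩
        sumBelow (k + (n ∸ k)) d
      ≡⟨ cong (λ m → sumBelow m d) (m+[n∸m]≡n k≤n) ⟩
        sumBelow n d
      ≡⟨ degree-sum ⟩
        n + n
      ≡⟨ cong (n +_) (sym (m+[n∸m]≡n k≤n)) ⟩
        n + (k + (n ∸ k))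
      ≡⟨ sym (+-assoc n k (n ∸ k)) ⟩
        n + k + (n ∸ k)
      ∎)
      where
      open ≡-Reasoning
      ones : sumBelow (n ∸ k) (λ j → d (k + j)) ≡ n ∸ k
      ones = trans (sumBelow-cong (n ∸ k) (λ j j<n-k → one (k + j) (m≤m+n k j)
                     (subst (k + j <_) (m+[n∸m]≡n k≤n) (+-monoʳ-< k j<n-k))))
                   (trans (sumBelow-const (n ∸ k) 1) (*-identityʳ _))

    three-large : Threshold 3 → Case3 D
    three-large (3≤n , large , one) = 3≤n , d 0 , d 1 , d 2 ,
      antitone 0 1 z≤n (≤-trans (s≤s (s≤s z≤n)) 3≤n) , antitone 1 2 (s≤s z≤n) 3≤n , large 2 (s≤s (s≤s (s≤s z≤n))) ,
      trans (+-assoc (d 0) (d 1) (d 2)) (trans (cong (λ x → d 0 + (d 1 + x)) (sym (+-identityʳ (d 2))))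
                                               (sum-large 3 (3≤n , large , one))) ,
      lookupℕ-ext D _ (sym (trans (cong (3 +_) (length-replicate (n ∸ 3))) (m+[n∸m]≡n 3≤n))) listed
      where
      listed : ∀ j → j < n → d j ≡ lookupℕ (d 0 ∷ d 1 ∷ d 2 ∷ replicate (n ∸ 3) 1) j
      listed 0 _ = refl
      listed 1 _ = refl
      listed 2 _ = refl
      listed (suc (suc (suc j))) j<n = trans (one (3 + j) (s≤s (s≤s (s≤s z≤n))) j<n)
        (sym (lookupℕ-replicate (n ∸ 3) 1 j (+-cancelˡ-< 3 j (n ∸ 3) (subst (3 + j <_) (sym (m+[n∸m]≡n 3≤n)) j<n))))

    -- With d 1 ≤ 2 every large term after the first is 2, and the first is then fixed by the sum.
    hub-shape : ∀ K′ L → n ≡ 4 + K′ + L → Threshold (4 + K′) → d 1 ≤ 2 → ∀ v → v < n → d v ≡ hubDegrees L (4 + K′) v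
    hub-shape K′ L n≡ (k≤n , large , one) d1≤2 v v<n with v
    ... | 0 = +-cancelʳ-≡ ((3 + K′) * 2) _ _ (trans first-sum (trans (cong (_+ (4 + K′)) n≡) (sym (rearrange K′ L))))
      where
      two : ∀ j → 1 ≤ j → j < 4 + K′ → d j ≡ 2
      two j 1≤j j<k = ≤-antisym (≤-trans (antitone 1 j 1≤j (≤-trans j<k k≤n)) d1≤2) (large j j<k)
      first-sum : d 0 + (3 + K′) * 2 ≡ n + (4 + K′)
      first-sum = trans (cong (d 0 +_) (sym (trans (sumBelow-cong (3 + K′) (λ j j<k′ → two (suc j) (s≤s z≤n) (s≤s j<k′)))
                                                   (sumBelow-const (3 + K′) 2))))
                        (sum-large (4 + K′) (k≤n , large , one))
      rearrange : ∀ K′ L → (2 + L) + (3 + K′) * 2 ≡ (4 + K′ + L) + (4 + K′)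
      rearrange = solve-∀
    ... | suc u with suc u <? 4 + K′
    ...   | yes 1+u<k = trans (≤-antisym (≤-trans (antitone 1 (suc u) (s≤s z≤n) v<n) d1≤2) (large (suc u) 1+u<k))
                              (sym (hubDegrees-body L (4 + K′) (suc u) (s≤s z≤n) 1+u<k))
    ...   | no 1+u≮k  = trans (one (suc u) (≮⇒≥ 1+u≮k) v<n) (sym (hubDegrees-tail L (4 + K′) u (≮⇒≥ 1+u≮k)))

    D≡hubList : ∀ K′ L → n ≡ 4 + K′ + L → (∀ v → v < n → d v ≡ hubDegrees L (4 + K′) v) → D ≡ hubList L (4 + K′)
    D≡hubList K′ L n≡ shape = lookupℕ-ext D (hubList L (4 + K′)) (trans n≡ (sym (length-hubList L (3 + K′))))
      (λ j j<n → trans (shape j j<n) (sym (lookupℕ-hubList L (3 + K′) j (subst (j <_) n≡ j<n))))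

    classify-hub : ∀ K′ L → n ≡ 4 + K′ + L → (∀ v → v < n → d v ≡ hubDegrees L (4 + K′) v) → Case1 D ⊎ Case2 D
    classify-hub 0 L n≡ shape =
      inj₂ (subst (4 ≤_) (sym n≡) (m≤m+n 4 L) ,
            subst (λ m → D ≡ (m ∸ 2) ∷ replicate 3 2 ++ replicate (m ∸ 4) 1) (sym n≡) (D≡hubList 0 L n≡ shape))
    classify-hub 1 0 n≡ shape = inj₁ (inj₁ (D≡hubList 1 0 n≡ shape))
    classify-hub 1 1 n≡ shape = inj₁ (inj₂ (D≡hubList 1 1 n≡ shape))
    classify-hub 1 (suc (suc L)) n≡ shape =
      ⊥-elim (not-disconnected (sym n≡) (Bowtie.bowtie-disconnected L) (λ v v<n → sym (shape v v<n)))
    classify-hub (suc (suc k)) L n≡ shape =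
      ⊥-elim (not-disconnected (sym n≡) (TwoCycles.twoCycles-disconnected k L) (λ v v<n → sym (shape v v<n)))

    -- Large second term: the chorded cycle needs at least k + 2 vertices, which the degree sum provides.
    chorded-impossible : ∀ K′ → Threshold (4 + K′) → 3 ≤ d 1 → ⊥
    chorded-impossible K′ (k≤n , large , one) 3≤d1 =
      not-disconnected refl (ChordedCycle.chordedCycle-disconnected K′ n d 6+K′≤n 3≤d0 3≤d1 large one
                               (sum-large (4 + K′) (k≤n , large , one))) (λ _ _ → refl)
      where
      3≤d0 : 3 ≤ d 0
      3≤d0 = ≤-trans 3≤d1 (antitone 0 1 z≤n (≤-trans (s≤s (s≤s z≤n)) k≤n))
      lower : 3 + (3 + (2 + K′) * 2) ≤ n + (4 + K′)
      lower = ≤-trans (+-mono-≤ 3≤d0 (+-mono-≤ 3≤d1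
                (≤-trans (≤-reflexive (sym (sumBelow-const (2 + K′) 2)))
                         (sumBelow-≤ (2 + K′) (λ j j<k → large (2 + j) (s≤s (s≤s j<k)))))))
                (≤-reflexive (sum-large (4 + K′) (k≤n , large , one)))
      6+K′≤n : 6 + K′ ≤ n
      6+K′≤n = +-cancelʳ-≤ (4 + K′) (6 + K′) n (≤-trans (≤-reflexive (rearrange K′)) lower)
        where
        rearrange : ∀ K′ → (6 + K′) + (4 + K′) ≡ 3 + (3 + (2 + K′) * 2)
        rearrange = solve-∀

    classify : ∀ k → Threshold k → Case1 D ⊎ Case2 D ⊎ Case3 D
    classify 0 T = ⊥-elim (1+n≰n (≤-trans 1≤n (≤-reflexive (sym (trans (sum-large 0 T) (+-identityʳ n))))))
    classify 1 T = ⊥-elim (<-irrefl refl (≤-trans (m<m+n n (s≤s z≤n))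
                     (≤-trans (m≤m+n (n + 1) 1) (subst (λ x → x + 1 ≤ n) d0≡ d0<n))))
      where
      d0≡ : d 0 ≡ n + 1
      d0≡ = trans (sym (+-identityʳ (d 0))) (sum-large 1 T)
      d0<n : d 0 + 1 ≤ n
      d0<n = subst (λ x → x + 1 ≤ n) (degree-at 0 1≤n) (degree+1≤n G₀ (fromℕ< 1≤n))
    classify 2 T@(2≤n , _ , one) = ⊥-elim (two-large-terms-impossible n G₀ d degree-G₀ 2≤n one
                                     (trans (cong (d 0 +_) (sym (+-identityʳ (d 1)))) (sum-large 2 T)))
    classify 3 T = inj₂ (inj₂ (three-large T))
    classify (suc (suc (suc (suc K′)))) T@(k≤n , _) with 3 ≤? d 1
    ... | yes 3≤d1 = ⊥-elim (chorded-impossible K′ T 3≤d1)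
    ... | no 3≰d1 = [ inj₁ , (λ c₂ → inj₂ (inj₁ c₂)) ]′
                      (classify-hub K′ L n≡ (hub-shape K′ L n≡ T (≤-pred (≰⇒> 3≰d1))))
      where
      L = n ∸ (4 + K′)
      n≡ : n ≡ 4 + K′ + L
      n≡ = sym (m+[n∸m]≡n k≤n)

  cases : Case1 D ⊎ Case2 D ⊎ Case3 D
  cases = classify (proj₁ threshold) (proj₂ threshold)

theorem3p1 : (D : List ℕ) → NonIncreasing D →
    (ForciblyUnicyclicGraphic D ⇔ (Case1 D ⊎ Case2 D ⊎ Case3 D))
theorem3p1 D nonIncreasing = mk⇔ (Classification.cases D nonIncreasing)
  [ case1-forcibly D , [ case2-forcibly D , case3-forcibly D ]′ ]′
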